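{- Let $\mathcal{M}$ be a simple oriented matroid (no loops, no parallel or antiparallel elements) on the ground set $E_t=\{1,\ldots,t\}$ which is not acyclic, and let $\mathcal{T}$ be its set of topes. Let $k$ be an integer with $3\leq k\leq|\mathcal{T}|-3$, and let $\ell\in\{k,\,|\mathcal{T}|-k\}$. Then: (i) \[ \#\mathbf{K}^{\ast}_k(\mathcal{M})=\#\mathbf{K}^{\ast}_{|\mathcal{T}|-k}(\mathcal{M}) =\binom{|\mathcal{T}|}{|\mathcal{T}|-\ell}+\sum_{G\in\boldsymbol{\mathcal{E}}\left(\bigcup_{e\in E_t}\binom{\mathcal{T}^+_e}{\lfloor(\ell+1)/2\rfloor}\right):\ 0<|G|\leq\ell}\mu_{\boldsymbol{\mathcal{E}}}(\hat{0},G)\cdot\binom{|\mathcal{T}|-|G|}{|\mathcal{T}|-\ell}\ ; \] (ii) \[ \#\mathbf{K}^{\ast}_k(\mathcal{M})=\#\mathbf{K}^{\ast}_{|\mathcal{T}|-k}(\mathcal{M})= -\sum_{G\in\boldsymbol{\mathcal{E}}\left(\bigcup_{e\in E_t}\binom{\mathcal{T}^+_e}{\lfloor(|\mathcal{T}|-\ell+1)/2\rfloor}\right):\ |G|>0}\mu_{\boldsymbol{\mathcal{E}}}(\hat{0},G)\cdot\sum_{\max\{1,\ell-|\mathcal{T}|+|G|\}\leq h\leq \min\{\ell,|G|\}}\binom{|G|}{h}\binom{|\mathcal{T}|-|G|}{\ell-h}\ . \]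
   Context: Topes are the maximal covectors of $\mathcal{M}$, viewed as sign vectors $T\in\{+,-\}^{E_t}$; the tope set satisfies $\mathcal{T}=-\mathcal{T}$. For $e\in E_t$, the positive halfspace is $\mathcal{T}^+_e:=\{T\in\mathcal{T}: T(e)=+\}$. For a set $S$ and integer $j$, $\binom{S}{j}$ denotes the family of all $j$-element subsets of $S$; $\bigcup_{e\in E_t}\binom{\mathcal{T}^+_e}{j}$ is the union of these families (a family of $j$-subsets of $\mathcal{T}$). For $3\leq k\leq|\mathcal{T}|-3$, the family of tope committees of cardinality $k$ is $\mathbf{K}^{\ast}_k(\mathcal{M}):=\{\mathcal{K}^{\ast}\subset\mathcal{T}: |\mathcal{K}^{\ast}|=k,\ |\mathcal{K}^{\ast}\cap\mathcal{T}^+_e|>k/2\ \ \forall e\in E_t\}$. For a family $\mathcal{G}$ of subsets of $\mathcal{T}$, $\boldsymbol{\mathcal{E}}(\mathcal{G})$ denotes the poset consisting of all unions $\bigcup_{F\in\mathcal{F}}F$ over nonempty subfamilies $\mathcal{F}\subseteq\mathcal{G}$, ordered by inclusion, with a new least element $\hat{0}$ adjoined; $\mu_{\boldsymbol{\mathcal{E}}}(\cdot,\cdot)$ is its Möbius function, and for $G\neq\hat 0$, $|G|$ is the cardinality of the set $G$. -}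

module Defs where

open import Level using (0ℓ)
open import Data.Nat using (ℕ; zero; suc; _+_; _*_; _∸_; _≤_; _<_; _⊔_; _⊓_; _≟_; _<?_; _≤?_)
open import Data.Nat.DivMod using (_/_)
open import Data.Nat.Combinatorics using (_C_)
open import Data.Nat.ListAction using (sum)
open import Data.Integer as ℤ using (ℤ; +_; -_)
open import Data.Fin using (Fin)
open import Data.Fin.Properties using (all?; any?)
open import Data.Fin.Subset using (Subset; outside; inside; _∪_; _∩_; _⊆_; _⊂_; ∣_∣; Nonempty)
  renaming (⊥ to ∅)
open import Data.Fin.Subset.Properties using (_⊆?_; _⊂?_; nonempty?)
open import Data.Vec as Vec using (Vec; []; _∷_; replicate; zipWith; tabulate)
open import Data.Vec.Properties using (≡-dec)
open import Data.List as List using (List; []; _∷_; [_]; _++_; filter; length; concatMap; upTo)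
open import Data.List.Relation.Unary.Any using (Any) renaming (any? to anyL?)
open import Data.Bool using (Bool; true; false; if_then_else_)
open import Data.Bool.Properties using () renaming (_≟_ to _≟B_)
open import Data.Product using (Σ; ∃; _×_; _,_)
open import Data.Sum using (_⊎_)
open import Relation.Nullary using (¬_; Dec; yes; no)
open import Relation.Nullary.Decidable using (_×-dec_; _→-dec_; ¬?)
open import Relation.Binary.PropositionalEquality using (_≡_; _≢_; refl)
open import Relation.Binary.Definitions using (DecidableEquality)

data Sign : Set where
  s0 s+ s- : Sign

_≟S_ : DecidableEquality Sign
s0 ≟S s0 = yes refl
s0 ≟S s+ = no λ ()
s0 ≟S s- = no λ ()
s+ ≟S s0 = no λ ()
s+ ≟S s+ = yes refl
s+ ≟S s- = no λ ()
s- ≟S s0 = no λ ()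
s- ≟S s+ = no λ ()
s- ≟S s- = yes refl

negS : Sign → Sign
negS s0 = s0
negS s+ = s-
negS s- = s+

_∘S_ : Sign → Sign → Sign
s0 ∘S y = y
s+ ∘S y = s+
s- ∘S y = s-

_·S_ : Sign → Sign → Sign
s0 ·S y = s0
s+ ·S y = y
s- ·S y = negS y

SignVec : ℕ → Set
SignVec t = Vec Sign t

infixl 30 _⟨_⟩
_⟨_⟩ : ∀ {t} → SignVec t → Fin t → Sign
X ⟨ e ⟩ = Vec.lookup X e

zeroV : ∀ {t} → SignVec t
zeroV = replicate _ s0

negV : ∀ {t} → SignVec t → SignVec t
negV = Vec.map negS

_∘V_ : ∀ {t} → SignVec t → SignVec t → SignVec t
_∘V_ = zipWith _∘S_

Separates : ∀ {t} → SignVec t → SignVec t → Fin t → Set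
Separates X Y e = X ⟨ e ⟩ ≢ s0 × Y ⟨ e ⟩ ≡ negS (X ⟨ e ⟩)

_≼_ : ∀ {t} → SignVec t → SignVec t → Set
X ≼ Y = ∀ e → (X ⟨ e ⟩ ≡ s0) ⊎ (X ⟨ e ⟩ ≡ Y ⟨ e ⟩)

_≼?_ : ∀ {t} (X Y : SignVec t) → Dec (X ≼ Y)
X ≼? Y = all? (λ e → (X ⟨ e ⟩ ≟S s0) ⊎-dec (X ⟨ e ⟩ ≟S Y ⟨ e ⟩))
  where open import Relation.Nullary.Decidable using (_⊎-dec_)

allSignVecs : ∀ t → List (SignVec t)
allSignVecs zero = [ [] ]
allSignVecs (suc t) = concatMap (λ v → (s0 ∷ v) ∷ (s+ ∷ v) ∷ (s- ∷ v) ∷ []) (allSignVecs t)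

∀SV? : ∀ {t} {P : SignVec t → Set} → (∀ Y → Dec (P Y)) → Dec (∀ Y → P Y)
∀SV? {zero} {P} d with d []
... | yes p = yes λ { [] → p }
... | no ¬p = no λ f → ¬p (f [])
∀SV? {suc t} {P} d with ∀SV? {t} (λ Y → d (s0 ∷ Y)) | ∀SV? {t} (λ Y → d (s+ ∷ Y)) | ∀SV? {t} (λ Y → d (s- ∷ Y))
... | yes a | yes b | yes c = yes λ { (s0 ∷ Y) → a Y ; (s+ ∷ Y) → b Y ; (s- ∷ Y) → c Y }
... | no ¬a | _ | _ = no λ f → ¬a (λ Y → f (s0 ∷ Y))
... | yes _ | no ¬b | _ = no λ f → ¬b (λ Y → f (s+ ∷ Y))
... | yes _ | yes _ | no ¬c = no λ f → ¬c (λ Y → f (s- ∷ Y))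

-- Oriented matroids on E_t, given by the covector axioms (L0)-(L3)

record OrientedMatroid (t : ℕ) : Set₁ where
  field
    IsCovector  : SignVec t → Set
    isCovector? : ∀ X → Dec (IsCovector X)
    zero-cov : IsCovector zeroV
    neg-cov  : ∀ {X} → IsCovector X → IsCovector (negV X)
    comp-cov : ∀ {X Y} → IsCovector X → IsCovector Y → IsCovector (X ∘V Y)
    elim-cov : ∀ {X Y} → IsCovector X → IsCovector Y → ∀ e → Separates X Y e →
               Σ (SignVec t) λ Z → IsCovector Z × Z ⟨ e ⟩ ≡ s0 ×
                 (∀ f → ¬ Separates X Y f → Z ⟨ f ⟩ ≡ (X ∘V Y) ⟨ f ⟩)

sumℤ : List ℤ → ℤ
sumℤ = List.foldr ℤ._+_ (+ 0)

-- Σ_{a ≤ h ≤ b} f h  (empty if b < a)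
sumRange : ℕ → ℕ → (ℕ → ℕ) → ℕ
sumRange a b f = sum (List.map (λ i → f (a + i)) (upTo (suc b ∸ a)))

allSubsets : ∀ n → List (Subset n)
allSubsets zero = [ [] ]
allSubsets (suc n) = List.map (outside ∷_) (allSubsets n) ++ List.map (inside ∷_) (allSubsets n)

module _ {t : ℕ} (M : OrientedMatroid t) where
  open OrientedMatroid M

  IsLoop : Fin t → Set
  IsLoop e = ∀ X → IsCovector X → X ⟨ e ⟩ ≡ s0

  Parallel : Fin t → Fin t → Set
  Parallel e f = ∀ X → IsCovector X → X ⟨ e ⟩ ≡ X ⟨ f ⟩

  Antiparallel : Fin t → Fin t → Set
  Antiparallel e f = ∀ X → IsCovector X → X ⟨ e ⟩ ≡ negS (X ⟨ f ⟩)

  Simple : Set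
  Simple = (∀ e → ¬ IsLoop e) ×
           (∀ e f → e ≢ f → ¬ Parallel e f × ¬ Antiparallel e f)

  Orthogonal : SignVec t → SignVec t → Set
  Orthogonal X Y = (∀ e → (X ⟨ e ⟩ ·S Y ⟨ e ⟩) ≡ s0)
                 ⊎ ((∃ λ e → (X ⟨ e ⟩ ·S Y ⟨ e ⟩) ≡ s+) × (∃ λ f → (X ⟨ f ⟩ ·S Y ⟨ f ⟩) ≡ s-))

  IsVector : SignVec t → Set
  IsVector V = ∀ X → IsCovector X → Orthogonal V X

  _⊑_ : SignVec t → SignVec t → Set
  V ⊑ C = ∀ e → V ⟨ e ⟩ ≢ s0 → C ⟨ e ⟩ ≢ s0

  IsCircuit : SignVec t → Set
  IsCircuit C = IsVector C × C ≢ zeroV ×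
                (∀ V → IsVector V → V ≢ zeroV → V ⊑ C → C ⊑ V)

  Acyclic : Set
  Acyclic = ¬ (Σ (SignVec t) λ C → IsCircuit C × (∀ e → C ⟨ e ⟩ ≢ s-))

  IsTope : SignVec t → Set
  IsTope X = IsCovector X × (∀ Y → IsCovector Y → X ≼ Y → Y ≡ X)

  isTope? : ∀ X → Dec (IsTope X)
  isTope? X = isCovector? X ×-dec
              ∀SV? (λ Y → isCovector? Y →-dec ((X ≼? Y) →-dec ≡-dec _≟S_ Y X))

  -- the tope set 𝒯 as a duplicate-free list; topes are indexed by Fin |𝒯|
  topes : List (SignVec t)
  topes = filter isTope? (allSignVecs t)

  #T : ℕ
  #T = length topes

  tope : Fin #T → SignVec t
  tope = List.lookup topes

  -- positive halfspace 𝒯⁺_e, as a subset of the tope indices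
  halfspace : Fin t → Subset #T
  halfspace e = tabulate λ i → isPlus (tope i ⟨ e ⟩)
    where
    isPlus : Sign → Bool
    isPlus s+ = true
    isPlus _  = false

  IsCommittee : ℕ → Subset #T → Set
  IsCommittee k K = ∣ K ∣ ≡ k × (∀ e → k < 2 * ∣ K ∩ halfspace e ∣)

  isCommittee? : ∀ k K → Dec (IsCommittee k K)
  isCommittee? k K = (∣ K ∣ ≟ k) ×-dec all? (λ e → k <? 2 * ∣ K ∩ halfspace e ∣)

  #committees : ℕ → ℕ
  #committees k = length (filter (isCommittee? k) (allSubsets #T))

  HalfspaceFamily : ℕ → Subset #T → Set
  HalfspaceFamily j S = ∣ S ∣ ≡ j × ∃ (λ e → S ⊆ halfspace e)

  halfspaceFamily : ℕ → List (Subset #T)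
  halfspaceFamily j = filter (λ S → (∣ S ∣ ≟ j) ×-dec any? (λ e → S ⊆? halfspace e)) (allSubsets #T)

-- The poset 𝓔(𝒢) of unions of nonempty subfamilies of a family 𝒢
-- of subsets of Fin n, with an adjoined least element 0̂, and its
-- Möbius function μ(0̂, ·).

module _ {n : ℕ} (𝒢 : List (Subset n)) where

  unionOf : ∀ (𝒢' : List (Subset n)) → Subset (length 𝒢') → Subset n
  unionOf [] [] = ∅
  unionOf (F ∷ 𝒢') (b ∷ S) = if b then F ∪ unionOf 𝒢' S else unionOf 𝒢' S

  IsUnion : Subset n → Set
  IsUnion G = Any (λ S → Nonempty S × unionOf 𝒢 S ≡ G) (allSubsets (length 𝒢))

  isUnion? : ∀ G → Dec (IsUnion G)
  isUnion? G = anyL? (λ S → nonempty? S ×-dec ≡-dec _≟B_ (unionOf 𝒢 S) G) (allSubsets (length 𝒢))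

  -- the elements of 𝓔(𝒢) other than 0̂ (each exactly once)
  𝓔 : List (Subset n)
  𝓔 = filter isUnion? (allSubsets n)

  -- Möbius function μ_𝓔(0̂, G), by the defining recursion
  --   μ(0̂,0̂) = 1,   μ(0̂,G) = - Σ_{0̂ ≤ H < G} μ(0̂,H) = -(1 + Σ_{H ∈ 𝓔∖{0̂}, H ⊊ G} μ(0̂,H)).
  -- The first argument is fuel; since H ⊊ G forces |H| < |G|, fuel |G|+1 suffices.
  mobiusF : ℕ → Subset n → ℤ
  mobiusF zero G = + 0
  mobiusF (suc m) G = - (+ 1 ℤ.+ sumℤ (List.map (mobiusF m) (filter (_⊂? G) 𝓔)))

  μ0̂ : Subset n → ℤ
  μ0̂ G = mobiusF (suc ∣ G ∣) G

module _ {t : ℕ} (M : OrientedMatroid t) where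

  private
    N = #T M

  formula-i : ℕ → ℤ
  formula-i ℓ = + (N C (N ∸ ℓ)) ℤ.+
    sumℤ (List.map (λ G → μ0̂ 𝒢 G ℤ.* + ((N ∸ ∣ G ∣) C (N ∸ ℓ)))
                   (filter (λ G → (1 ≤? ∣ G ∣) ×-dec (∣ G ∣ ≤? ℓ)) (𝓔 𝒢)))
    where 𝒢 = halfspaceFamily M ((ℓ + 1) / 2)

  formula-ii : ℕ → ℤ
  formula-ii ℓ = - sumℤ (List.map (λ G → μ0̂ 𝒢 G ℤ.* + inner G)
                                  (filter (λ G → 1 ≤? ∣ G ∣) (𝓔 𝒢)))
    where
    𝒢 = halfspaceFamily M ((N ∸ ℓ + 1) / 2)
    inner : Subset N → ℕ
    inner G = sumRange (1 ⊔ ((ℓ + ∣ G ∣) ∸ N)) (ℓ ⊓ ∣ G ∣)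
                       (λ h → (∣ G ∣ C h) * ((N ∸ ∣ G ∣) C (ℓ ∸ h)))

-- Opposite topes pair off 𝒯, and since M has no loops a tope T lies in 𝒯⁺_e exactly when -T
-- does not.  Hence every halfspace holds half of the topes, K ↦ -K turns committees of size k
-- into "anti-committees" (sets A of size k with 2 |A ∩ 𝒯⁺_e| < k for every e), and
-- complementation turns anti-committees of size ℓ into committees of size |𝒯| - ℓ; together
-- these give the symmetry k ↔ |𝒯| - k.  An ℓ-set is an anti-committee exactly when it contains
-- no ⌊(ℓ+1)/2⌋-subset of a positive halfspace, and the crosscut theorem for the lattice 𝓔 of
-- unions of such subsets writes the indicator of "A contains none of them" as
-- 1 + Σ_{G ∈ 𝓔, G ⊆ A} μ(0̂, G).  Summing over ℓ-sets and counting the ℓ-sets containing G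
-- gives (i); summing over complements of ℓ-sets and using Σ_G μ(0̂, G) = -1 together with
-- Vandermonde's identity gives (ii).

module Submission where

open import Defs
open import Level using (Level)
open import Function using (_∘_; _∋_; id)
open import Function.Bundles using (_⇔_; mk⇔; Equivalence)
open import Data.Empty using (⊥; ⊥-elim)
open import Data.Product using (Σ; _×_; _,_; proj₁; proj₂)
open import Data.Sum using (_⊎_; inj₁; inj₂; map₂)
open import Data.Bool using (Bool; true; false; not; _∧_; if_then_else_)
open import Data.Bool.Properties using () renaming (_≟_ to _≟ᵇ_)
open import Data.Nat as ℕ using (ℕ; zero; suc; _≤_; _<_; _∸_; _⊔_; _⊓_; z≤n; s≤s)
import Data.Nat.Properties as ℕ
open import Data.Nat.DivMod using (_/_; m/n*n≤m; m*n/n≡m; /-monoˡ-≤)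
open import Data.Nat.Combinatorics using (_C_; nCk≡nC[n∸k]; nCk+nC[k+1]≡[n+1]C[k+1]; k>n⇒nCk≡0)
open import Data.Nat.ListAction using (sum)
import Data.Nat.Tactic.RingSolver as ℕ-Solver
open import Data.Integer as ℤ using (ℤ; +_; -_; _+_; _*_; 0ℤ; 1ℤ)
import Data.Integer.Properties as ℤ
import Data.Integer.Tactic.RingSolver as ℤ-Solver
open import Data.List as List using (List; []; _∷_; _++_; filter; length; concatMap; applyUpTo; allFin)
import Data.List.Properties as List
open import Data.List.Membership.Propositional using (_∈_; lose; find)
open import Data.List.Membership.Propositional.Properties
  using (∈-map⁺; ∈-++⁺ˡ; ∈-++⁺ʳ; ∈-concatMap⁺; ∈-filter⁺; ∈-filter⁻; ∈-lookup)
open import Data.List.Relation.Unary.Any as Any using (Any; here; there; satisfied)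
open import Data.List.Relation.Unary.Any.Properties using (lookup-index)
open import Data.Fin as Fin using (Fin; zero; suc)
import Data.Fin.Properties as Fin
open import Data.Fin.Properties using (all?)
open import Data.Fin.Subset using (Subset; inside; outside; ∣_∣; _⊆_; _⊂_; _∉_; _∪_; _∩_; ∁; Nonempty)
  renaming (⊥ to ∅; ⊤ to ⊤ₛ)
open import Data.Fin.Subset.Properties
  using ( _⊆?_; _⊂?_; ⊆-refl; ⊆-trans; ⊂-irref; ⊥⊆; ⊆⊤; drop-∷-⊆; out⊆; s⊆s; out⊂; s⊂s; out⊂in
        ; p⊆p∪q; q⊆p∪q; x∈p∪q⁻; x∈p∩q⁺; p∩q⊆p; p∩q⊆q; ∩-identityˡ
        ; ∣⊥∣≡0; ∣⊤∣≡n; ∣p∣≤n; ∣∁p∣≡n∸∣p∣; p⊆q⇒∣p∣≤∣q∣; p⊂q⇒∣p∣<∣q∣; ∪-∩-booleanAlgebra)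
import Algebra.Lattice.Properties.BooleanAlgebra as BooleanAlgebra
import Algebra.Properties.CommutativeSemigroup as CommutativeSemigroup
open import Data.Vec as Vec using (Vec; []; _∷_; here; there; tabulate)
open import Data.Vec.Properties
  using (≡-dec; ∷-injective; lookup-map; lookup-zipWith; lookup-replicate; lookup∘tabulate; tabulate-cong; tabulate∘lookup)
open import Relation.Nullary using (¬_; Dec; yes; no; does)
open import Relation.Nullary.Decidable using (_×-dec_; ¬?)
open import Relation.Unary using (Pred; Decidable)
open import Relation.Binary.Definitions using (DecidableEquality)
open import Relation.Binary.PropositionalEquality
  using (_≡_; _≢_; refl; sym; trans; cong; cong₂; subst; subst₂; module ≡-Reasoning)

private
  module ℤ+ = CommutativeSemigroup ℤ.+-commutativeSemigroup
  module ℤ* = CommutativeSemigroup ℤ.*-commutativeSemigroup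
  module ℕ+ = CommutativeSemigroup ℕ.+-commutativeSemigroup

private
  variable
    a b p q : Level
    A : Set a
    B : Set b
    P : Set p
    Q : Set q
    n : ℕ

∑ : List A → (A → ℤ) → ℤ
∑ xs f = sumℤ (List.map f xs)

𝟙ᵇ : Bool → ℤ
𝟙ᵇ true  = 1ℤ
𝟙ᵇ false = 0ℤ

𝟙 : Dec P → ℤ
𝟙 d = 𝟙ᵇ (does d)

𝟙-yes : P → (d : Dec P) → 𝟙 d ≡ 1ℤ
𝟙-yes p (yes _) = refl
𝟙-yes p (no ¬p) = ⊥-elim (¬p p)

𝟙-no : ¬ P → (d : Dec P) → 𝟙 d ≡ 0ℤ
𝟙-no ¬p (yes p) = ⊥-elim (¬p p)
𝟙-no ¬p (no _)  = refl

𝟙-cong : (P → Q) → (Q → P) → (d : Dec P) (e : Dec Q) → 𝟙 d ≡ 𝟙 e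
𝟙-cong f g (yes p) e = sym (𝟙-yes (f p) e)
𝟙-cong f g (no ¬p) e = sym (𝟙-no (λ q → ¬p (g q)) e)

𝟙-× : (d : Dec P) (e : Dec Q) → 𝟙 (d ×-dec e) ≡ 𝟙 d * 𝟙 e
𝟙-× (yes _) (yes _) = refl
𝟙-× (yes _) (no _)  = refl
𝟙-× (no _)  (yes _) = refl
𝟙-× (no _)  (no _)  = refl

∑-cong : ∀ (xs : List A) {f g : A → ℤ} → (∀ x → f x ≡ g x) → ∑ xs f ≡ ∑ xs g
∑-cong []       f≗g = refl
∑-cong (x ∷ xs) f≗g = cong₂ _+_ (f≗g x) (∑-cong xs f≗g)

∑-++ : ∀ (xs ys : List A) f → ∑ (xs ++ ys) f ≡ ∑ xs f + ∑ ys f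
∑-++ []       ys f = sym (ℤ.+-identityˡ _)
∑-++ (x ∷ xs) ys f = trans (cong (λ s → f x + s) (∑-++ xs ys f)) (sym (ℤ.+-assoc (f x) _ _))

∑-map : ∀ (g : A → B) (xs : List A) f → ∑ (List.map g xs) f ≡ ∑ xs (λ x → f (g x))
∑-map g []       f = refl
∑-map g (x ∷ xs) f = cong (λ s → f (g x) + s) (∑-map g xs f)

∑-0 : ∀ (xs : List A) {f : A → ℤ} → (∀ x → f x ≡ 0ℤ) → ∑ xs f ≡ 0ℤ
∑-0 []       f≗0 = refl
∑-0 (x ∷ xs) f≗0 = cong₂ _+_ (f≗0 x) (∑-0 xs f≗0)

∑-distrib-+ : ∀ (xs : List A) f g → ∑ xs (λ x → f x + g x) ≡ ∑ xs f + ∑ xs g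
∑-distrib-+ []       f g = refl
∑-distrib-+ (x ∷ xs) f g =
  trans (cong (λ s → f x + g x + s) (∑-distrib-+ xs f g)) (ℤ+.interchange (f x) (g x) (∑ xs f) (∑ xs g))

∑-*ˡ : ∀ (xs : List A) c f → ∑ xs (λ x → c * f x) ≡ c * ∑ xs f
∑-*ˡ []       c f = sym (ℤ.*-zeroʳ c)
∑-*ˡ (x ∷ xs) c f = trans (cong (λ s → c * f x + s) (∑-*ˡ xs c f)) (sym (ℤ.*-distribˡ-+ c (f x) _))

∑-*ʳ : ∀ (xs : List A) c f → ∑ xs (λ x → f x * c) ≡ ∑ xs f * c
∑-*ʳ xs c f = trans (∑-cong xs (λ x → ℤ.*-comm (f x) c)) (trans (∑-*ˡ xs c f) (ℤ.*-comm c _))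

∑-neg : ∀ (xs : List A) f → ∑ xs (λ x → - f x) ≡ - ∑ xs f
∑-neg []       f = refl
∑-neg (x ∷ xs) f = trans (cong (λ s → - f x + s) (∑-neg xs f)) (sym (ℤ.neg-distrib-+ (f x) _))

∑-comm : ∀ (xs : List A) (ys : List B) (f : A → B → ℤ) →
         ∑ xs (λ x → ∑ ys (f x)) ≡ ∑ ys (λ y → ∑ xs (λ x → f x y))
∑-comm []       ys f = sym (∑-0 ys (λ _ → refl))
∑-comm (x ∷ xs) ys f =
  trans (cong (λ s → ∑ ys (f x) + s) (∑-comm xs ys f)) (sym (∑-distrib-+ ys (f x) _))

∑-*-∑ : ∀ (xs : List A) (ys : List B) (a : A → ℤ) (g : A → B → ℤ) →
        ∑ xs (λ x → a x * ∑ ys (g x)) ≡ ∑ ys (λ y → ∑ xs (λ x → a x * g x y))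
∑-*-∑ xs ys a g = trans (∑-cong xs (λ x → sym (∑-*ˡ ys (a x) (g x)))) (∑-comm xs ys _)

∑-filter : ∀ {R : Pred A p} (R? : Decidable R) (xs : List A) f →
           ∑ (filter R? xs) f ≡ ∑ xs (λ x → 𝟙 (R? x) * f x)
∑-filter R? []       f = refl
∑-filter R? (x ∷ xs) f with R? x
... | yes _ = cong₂ _+_ (sym (ℤ.*-identityˡ (f x))) (∑-filter R? xs f)
... | no  _ = trans (∑-filter R? xs f) (sym (ℤ.+-identityˡ _))

∑-filter-cong : ∀ {R : Pred A p} (R? : Decidable R) (xs : List A) {f g : A → ℤ} →
                (∀ x → R x → f x ≡ g x) → ∑ (filter R? xs) f ≡ ∑ (filter R? xs) g
∑-filter-cong R? []       f≗g = refl
∑-filter-cong R? (x ∷ xs) f≗g with R? x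
... | yes r = cong₂ _+_ (f≗g x r) (∑-filter-cong R? xs f≗g)
... | no  _ = ∑-filter-cong R? xs f≗g

∑-filter-redundant : ∀ {R : Pred A p} (R? : Decidable R) (xs : List A) {f : A → ℤ} →
                     (∀ {x} → x ∈ xs → ¬ R x → f x ≡ 0ℤ) → ∑ (filter R? xs) f ≡ ∑ xs f
∑-filter-redundant R? []       f≡0 = refl
∑-filter-redundant R? (x ∷ xs) {f} f≡0 with R? x
... | yes _ = cong (λ s → f x + s) (∑-filter-redundant R? xs (f≡0 ∘ there))
... | no ¬r = trans (∑-filter-redundant R? xs (f≡0 ∘ there))
                    (sym (trans (cong (_+ ∑ xs f) (f≡0 (here refl) ¬r)) (ℤ.+-identityˡ _)))

length-filter≡∑𝟙 : ∀ {R : Pred A p} (R? : Decidable R) (xs : List A) →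
                   + length (filter R? xs) ≡ ∑ xs (λ x → 𝟙 (R? x))
length-filter≡∑𝟙 R? []       = refl
length-filter≡∑𝟙 R? (x ∷ xs) with R? x
... | yes _ = cong (λ s → 1ℤ + s) (length-filter≡∑𝟙 R? xs)
... | no  _ = trans (length-filter≡∑𝟙 R? xs) (sym (ℤ.+-identityˡ _))

module Enumeration {A : Set a} (_≟_ : DecidableEquality A) (xs : List A)
                   (exactlyOnce : ∀ y → ∑ xs (λ x → 𝟙 (x ≟ y)) ≡ 1ℤ) where

  ∑-δ : ∀ y (f : A → ℤ) → ∑ xs (λ x → 𝟙 (x ≟ y) * f x) ≡ f y
  ∑-δ y f = begin
    ∑ xs (λ x → 𝟙 (x ≟ y) * f x) ≡⟨ ∑-cong xs evaluateAt-y ⟩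
    ∑ xs (λ x → 𝟙 (x ≟ y) * f y) ≡⟨ ∑-*ʳ xs (f y) (λ x → 𝟙 (x ≟ y)) ⟩
    ∑ xs (λ x → 𝟙 (x ≟ y)) * f y ≡⟨ cong (_* f y) (exactlyOnce y) ⟩
    1ℤ * f y                     ≡⟨ ℤ.*-identityˡ (f y) ⟩
    f y                          ∎
    where
    open ≡-Reasoning
    evaluateAt-y : ∀ x → 𝟙 (x ≟ y) * f x ≡ 𝟙 (x ≟ y) * f y
    evaluateAt-y x with x ≟ y
    ... | yes refl = refl
    ... | no  _    = refl

  ∑-filter-δ : ∀ {R : Pred A p} (R? : Decidable R) {y} → R y → ∀ (f : A → ℤ) →
               ∑ (filter R? xs) (λ x → 𝟙 (x ≟ y) * f x) ≡ f y
  ∑-filter-δ R? {y} r f = begin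
    ∑ (filter R? xs) (λ x → 𝟙 (x ≟ y) * f x)        ≡⟨ ∑-filter R? xs _ ⟩
    ∑ xs (λ x → 𝟙 (R? x) * (𝟙 (x ≟ y) * f x))       ≡⟨ ∑-cong xs (λ x → ℤ*.x∙yz≈y∙xz (𝟙 (R? x)) (𝟙 (x ≟ y)) (f x)) ⟩
    ∑ xs (λ x → 𝟙 (x ≟ y) * (𝟙 (R? x) * f x))       ≡⟨ ∑-δ y (λ x → 𝟙 (R? x) * f x) ⟩
    𝟙 (R? y) * f y                                  ≡⟨ cong (_* f y) (𝟙-yes r (R? y)) ⟩
    1ℤ * f y                                        ≡⟨ ℤ.*-identityˡ (f y) ⟩
    f y                                             ∎
    where open ≡-Reasoning

  ∑-reindex : (φ ψ : A → A) → (∀ x → ψ (φ x) ≡ x) → (∀ y → φ (ψ y) ≡ y) →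
              ∀ (f : A → ℤ) → ∑ xs (λ x → f (φ x)) ≡ ∑ xs f
  ∑-reindex φ ψ ψφ φψ f = begin
    ∑ xs (λ x → f (φ x))                                ≡⟨ ∑-cong xs (λ x → sym (∑-δ (φ x) f)) ⟩
    ∑ xs (λ x → ∑ xs (λ y → 𝟙 (y ≟ φ x) * f y))         ≡⟨ ∑-comm xs xs _ ⟩
    ∑ xs (λ y → ∑ xs (λ x → 𝟙 (y ≟ φ x) * f y))         ≡⟨ ∑-cong xs (λ y → ∑-*ʳ xs (f y) _) ⟩
    ∑ xs (λ y → ∑ xs (λ x → 𝟙 (y ≟ φ x)) * f y)         ≡⟨ ∑-cong xs (λ y → cong (_* f y) (fibre y)) ⟩
    ∑ xs (λ y → 1ℤ * f y)                               ≡⟨ ∑-cong xs (λ y → ℤ.*-identityˡ (f y)) ⟩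
    ∑ xs f                                              ∎
    where
    open ≡-Reasoning
    fibre : ∀ y → ∑ xs (λ x → 𝟙 (y ≟ φ x)) ≡ 1ℤ
    fibre y = trans (∑-cong xs (λ x → 𝟙-cong (to x) (from x) (y ≟ φ x) (x ≟ ψ y))) (exactlyOnce (ψ y))
      where
      to : ∀ x → y ≡ φ x → x ≡ ψ y
      to x refl = sym (ψφ x)
      from : ∀ x → x ≡ ψ y → y ≡ φ x
      from x refl = sym (φψ y)

∑ₛ : ∀ n → (Subset n → ℤ) → ℤ
∑ₛ n = ∑ (allSubsets n)

∑ₛ-suc : ∀ n f → ∑ₛ (suc n) f ≡ ∑ₛ n (f ∘ (outside ∷_)) + ∑ₛ n (f ∘ (inside ∷_))
∑ₛ-suc n f = trans (∑-++ (List.map (outside ∷_) (allSubsets n)) _ f)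
                   (cong₂ _+_ (∑-map (outside ∷_) (allSubsets n) f) (∑-map (inside ∷_) (allSubsets n) f))

_≟ₛ_ : DecidableEquality (Subset n)
_≟ₛ_ = ≡-dec _≟ᵇ_

allSubsets-exactlyOnce : ∀ n (q : Subset n) → ∑ₛ n (λ p → 𝟙 (p ≟ₛ q)) ≡ 1ℤ
allSubsets-exactlyOnce zero    []      = refl
allSubsets-exactlyOnce (suc n) (b ∷ q) = trans (∑ₛ-suc n _) (split b)
  where
  same : ∀ c → ∑ₛ n (λ p → 𝟙 ((c ∷ p) ≟ₛ (c ∷ q))) ≡ 1ℤ
  same c = trans (∑-cong (allSubsets n) (λ p → 𝟙-cong (proj₂ ∘ ∷-injective) (cong (c ∷_)) ((c ∷ p) ≟ₛ (c ∷ q)) (p ≟ₛ q)))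
                 (allSubsets-exactlyOnce n q)
  other : ∀ c d → c ≢ d → ∑ₛ n (λ p → 𝟙 ((c ∷ p) ≟ₛ (d ∷ q))) ≡ 0ℤ
  other c d c≢d = ∑-0 (allSubsets n) (λ p → 𝟙-no (c≢d ∘ proj₁ ∘ ∷-injective) ((c ∷ p) ≟ₛ (d ∷ q)))
  split : ∀ b → ∑ₛ n (λ p → 𝟙 ((outside ∷ p) ≟ₛ (b ∷ q))) + ∑ₛ n (λ p → 𝟙 ((inside ∷ p) ≟ₛ (b ∷ q))) ≡ 1ℤ
  split false = cong₂ _+_ (same false) (other true false λ ())
  split true  = cong₂ _+_ (other false true λ ()) (same true)

∈-allSubsets : ∀ n (p : Subset n) → p ∈ allSubsets n
∈-allSubsets zero    []            = here refl
∈-allSubsets (suc n) (outside ∷ p) = ∈-++⁺ˡ (∈-map⁺ (outside ∷_) (∈-allSubsets n p))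
∈-allSubsets (suc n) (inside ∷ p)  =
  ∈-++⁺ʳ (List.map (outside ∷_) (allSubsets n)) (∈-map⁺ (inside ∷_) (∈-allSubsets n p))

module SubsetEnumeration (n : ℕ) = Enumeration (_≟ₛ_ {n}) (allSubsets n) (allSubsets-exactlyOnce n)

∑-allFin-suc : ∀ n (f : Fin (suc n) → ℤ) → ∑ (allFin (suc n)) f ≡ f zero + ∑ (allFin n) (f ∘ suc)
∑-allFin-suc n f = cong (λ s → f zero + s)
  (trans (cong (λ xs → ∑ xs f) (sym (List.map-tabulate id suc))) (∑-map suc (allFin n) f))

allFin-exactlyOnce : ∀ n (j : Fin n) → ∑ (allFin n) (λ i → 𝟙 (i Fin.≟ j)) ≡ 1ℤ
allFin-exactlyOnce (suc n) zero    = trans (∑-allFin-suc n (λ i → 𝟙 (i Fin.≟ zero)))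
  (cong (λ s → 1ℤ + s) (∑-0 (allFin n) (λ i → 𝟙-no (λ ()) (suc i Fin.≟ zero))))
allFin-exactlyOnce (suc n) (suc j) = trans (∑-allFin-suc n (λ i → 𝟙 (i Fin.≟ suc j))) (trans (ℤ.+-identityˡ _)
  (trans (∑-cong (allFin n) (λ i → 𝟙-cong Fin.suc-injective (cong suc) (suc i Fin.≟ suc j) (i Fin.≟ j)))
         (allFin-exactlyOnce n j)))

module FinEnumeration (n : ℕ) = Enumeration (Fin._≟_ {n}) (allFin n) (allFin-exactlyOnce n)

∣p∣≡∑ : ∀ (p : Subset n) → + ∣ p ∣ ≡ ∑ (allFin n) (λ i → 𝟙ᵇ (Vec.lookup p i))
∣p∣≡∑ []            = refl
∣p∣≡∑ (inside ∷ p)  = trans (cong (λ s → 1ℤ + s) (∣p∣≡∑ p)) (sym (∑-allFin-suc _ (𝟙ᵇ ∘ Vec.lookup (inside ∷ p))))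
∣p∣≡∑ (outside ∷ p) = trans (∣p∣≡∑ p) (sym (trans (∑-allFin-suc _ (𝟙ᵇ ∘ Vec.lookup (outside ∷ p))) (ℤ.+-identityˡ _)))

∁-involutive : ∀ (p : Subset n) → ∁ (∁ p) ≡ p
∁-involutive {n} = BooleanAlgebra.¬-involutive (∪-∩-booleanAlgebra n)

∣∁p∩q∣+∣p∩q∣≡∣q∣ : ∀ (p q : Subset n) → ∣ ∁ p ∩ q ∣ ℕ.+ ∣ p ∩ q ∣ ≡ ∣ q ∣
∣∁p∩q∣+∣p∩q∣≡∣q∣ []            []            = refl
∣∁p∩q∣+∣p∩q∣≡∣q∣ (outside ∷ p) (outside ∷ q) = ∣∁p∩q∣+∣p∩q∣≡∣q∣ p q
∣∁p∩q∣+∣p∩q∣≡∣q∣ (outside ∷ p) (inside ∷ q)  = cong suc (∣∁p∩q∣+∣p∩q∣≡∣q∣ p q)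
∣∁p∩q∣+∣p∩q∣≡∣q∣ (inside ∷ p)  (outside ∷ q) = ∣∁p∩q∣+∣p∩q∣≡∣q∣ p q
∣∁p∩q∣+∣p∩q∣≡∣q∣ (inside ∷ p)  (inside ∷ q)  =
  trans (ℕ.+-suc _ _) (cong suc (∣∁p∩q∣+∣p∩q∣≡∣q∣ p q))

⊆∧≢⇒⊂ : ∀ {p q : Subset n} → p ⊆ q → p ≢ q → p ⊂ q
⊆∧≢⇒⊂ {p = []}          {[]}          _   p≢q = ⊥-elim (p≢q refl)
⊆∧≢⇒⊂ {p = outside ∷ p} {outside ∷ q} p⊆q p≢q = out⊂ (⊆∧≢⇒⊂ (drop-∷-⊆ p⊆q) (p≢q ∘ cong (outside ∷_)))
⊆∧≢⇒⊂ {p = outside ∷ p} {inside ∷ q}  p⊆q _   = out⊂in (drop-∷-⊆ p⊆q)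
⊆∧≢⇒⊂ {p = inside ∷ p}  {outside ∷ q} p⊆q _   with p⊆q here
... | ()
⊆∧≢⇒⊂ {p = inside ∷ p}  {inside ∷ q}  p⊆q p≢q = s⊂s (⊆∧≢⇒⊂ (drop-∷-⊆ p⊆q) (p≢q ∘ cong (inside ∷_)))

∪-least : ∀ {p q r : Subset n} → p ⊆ r → q ⊆ r → p ∪ q ⊆ r
∪-least {p = p} {q} p⊆r q⊆r x∈p∪q with x∈p∪q⁻ p q x∈p∪q
... | inj₁ x∈p = p⊆r x∈p
... | inj₂ x∈q = q⊆r x∈q

subsetOfSize : ∀ (p : Subset n) j → j ≤ ∣ p ∣ → Σ (Subset n) λ q → q ⊆ p × ∣ q ∣ ≡ j
subsetOfSize {n} p zero _ = ∅ , ⊥⊆ , ∣⊥∣≡0 n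
subsetOfSize (inside ∷ p) (suc j) (s≤s j≤∣p∣) with subsetOfSize p j j≤∣p∣
... | q , q⊆p , ∣q∣≡j = inside ∷ q , s⊆s q⊆p , cong suc ∣q∣≡j
subsetOfSize (outside ∷ p) (suc j) j<∣p∣ with subsetOfSize p (suc j) j<∣p∣
... | q , q⊆p , ∣q∣≡j = outside ∷ q , out⊆ q⊆p , ∣q∣≡j

𝟙-out⊆ : ∀ b (p q : Subset n) → 𝟙 ((outside ∷ p) ⊆? (b ∷ q)) ≡ 𝟙 (p ⊆? q)
𝟙-out⊆ b p q = 𝟙-cong drop-∷-⊆ out⊆ ((outside ∷ p) ⊆? (b ∷ q)) (p ⊆? q)

𝟙-in⊆in : ∀ (p q : Subset n) → 𝟙 ((inside ∷ p) ⊆? (inside ∷ q)) ≡ 𝟙 (p ⊆? q)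
𝟙-in⊆in p q = 𝟙-cong drop-∷-⊆ s⊆s ((inside ∷ p) ⊆? (inside ∷ q)) (p ⊆? q)

𝟙-in⊆out : ∀ (p q : Subset n) → 𝟙 ((inside ∷ p) ⊆? (outside ∷ q)) ≡ 0ℤ
𝟙-in⊆out p q = 𝟙-no (λ p⊆q → 0∉out (p⊆q here)) ((inside ∷ p) ⊆? (outside ∷ q))
  where
  0∉out : Fin.zero ∉ outside ∷ q
  0∉out ()

∣p∣≡n∸∣∁p∣ : ∀ (p : Subset n) → ∣ p ∣ ≡ n ∸ ∣ ∁ p ∣
∣p∣≡n∸∣∁p∣ {n} p = trans (sym (ℕ.m∸[m∸n]≡n (∣p∣≤n p))) (cong (n ∸_) (sym (∣∁p∣≡n∸∣p∣ p)))

∑ₛ-ofSize-disjoint : ∀ n (G : Subset n) c →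
  ∑ₛ n (λ A → 𝟙 (∣ A ∣ ℕ.≟ c) * 𝟙 (G ⊆? ∁ A)) ≡ + ((n ∸ ∣ G ∣) C c)
∑ₛ-ofSize-disjoint zero    []            zero    = cong (λ x → 1ℤ * x + 0ℤ) (𝟙-yes {P = [] ⊆ []} ⊥⊆ ([] ⊆? []))
∑ₛ-ofSize-disjoint zero    []            (suc c) = refl
∑ₛ-ofSize-disjoint (suc n) (inside ∷ G)  c       = begin
  ∑ₛ (suc n) (λ A → 𝟙 (∣ A ∣ ℕ.≟ c) * 𝟙 ((inside ∷ G) ⊆? ∁ A))
      ≡⟨ ∑ₛ-suc n _ ⟩
  ∑ₛ n (λ A → 𝟙 (∣ A ∣ ℕ.≟ c) * 𝟙 ((inside ∷ G) ⊆? (inside ∷ ∁ A)))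
    + ∑ₛ n (λ A → 𝟙 (suc ∣ A ∣ ℕ.≟ c) * 𝟙 ((inside ∷ G) ⊆? (outside ∷ ∁ A)))
      ≡⟨ cong₂ _+_ (∑-cong (allSubsets n) (λ A → cong (𝟙 (∣ A ∣ ℕ.≟ c) *_) (𝟙-in⊆in G (∁ A))))
                   (∑-0 (allSubsets n) (λ A → trans (cong (𝟙 (suc ∣ A ∣ ℕ.≟ c) *_) (𝟙-in⊆out G (∁ A)))
                                                    (ℤ.*-zeroʳ (𝟙 (suc ∣ A ∣ ℕ.≟ c))))) ⟩
  ∑ₛ n (λ A → 𝟙 (∣ A ∣ ℕ.≟ c) * 𝟙 (G ⊆? ∁ A)) + 0ℤ
      ≡⟨ trans (ℤ.+-identityʳ _) (∑ₛ-ofSize-disjoint n G c) ⟩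
  + ((n ∸ ∣ G ∣) C c) ∎
  where open ≡-Reasoning
∑ₛ-ofSize-disjoint (suc n) (outside ∷ G) zero    = begin
  ∑ₛ (suc n) (λ A → 𝟙 (∣ A ∣ ℕ.≟ 0) * 𝟙 ((outside ∷ G) ⊆? ∁ A))
      ≡⟨ trans (∑ₛ-suc n _) (cong₂ _+_ (∑-cong (allSubsets n) (λ A → cong (𝟙 (∣ A ∣ ℕ.≟ 0) *_) (𝟙-out⊆ inside G (∁ A))))
                                      (∑-cong (allSubsets n) (λ A → cong (𝟙 (suc ∣ A ∣ ℕ.≟ 0) *_) (𝟙-out⊆ outside G (∁ A))))) ⟩
  ∑ₛ n (λ A → 𝟙 (∣ A ∣ ℕ.≟ 0) * 𝟙 (G ⊆? ∁ A)) + ∑ₛ n (λ A → 𝟙 (suc ∣ A ∣ ℕ.≟ 0) * 𝟙 (G ⊆? ∁ A))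
      ≡⟨ cong₂ _+_ (∑ₛ-ofSize-disjoint n G 0)
                   (∑-0 (allSubsets n) (λ A → cong (_* 𝟙 (G ⊆? ∁ A)) (𝟙-no (λ ()) (suc ∣ A ∣ ℕ.≟ 0)))) ⟩
  + ((n ∸ ∣ G ∣) C 0) + 0ℤ
      ≡⟨ ℤ.+-identityʳ _ ⟩
  + ((suc n ∸ ∣ G ∣) C 0) ∎
  where open ≡-Reasoning
∑ₛ-ofSize-disjoint (suc n) (outside ∷ G) (suc c) = begin
  ∑ₛ (suc n) (λ A → 𝟙 (∣ A ∣ ℕ.≟ suc c) * 𝟙 ((outside ∷ G) ⊆? ∁ A))
      ≡⟨ trans (∑ₛ-suc n _) (cong₂ _+_ (∑-cong (allSubsets n) (λ A → cong (𝟙 (∣ A ∣ ℕ.≟ suc c) *_) (𝟙-out⊆ inside G (∁ A))))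
                                      (∑-cong (allSubsets n) (λ A → cong (𝟙 (suc ∣ A ∣ ℕ.≟ suc c) *_) (𝟙-out⊆ outside G (∁ A))))) ⟩
  ∑ₛ n (λ A → 𝟙 (∣ A ∣ ℕ.≟ suc c) * 𝟙 (G ⊆? ∁ A)) + ∑ₛ n (λ A → 𝟙 (suc ∣ A ∣ ℕ.≟ suc c) * 𝟙 (G ⊆? ∁ A))
      ≡⟨ cong₂ _+_ (∑ₛ-ofSize-disjoint n G (suc c))
                   (trans (∑-cong (allSubsets n) (λ A → cong (_* 𝟙 (G ⊆? ∁ A))
                            (𝟙-cong ℕ.suc-injective (cong suc) (suc ∣ A ∣ ℕ.≟ suc c) (∣ A ∣ ℕ.≟ c))))
                          (∑ₛ-ofSize-disjoint n G c)) ⟩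
  + ((n ∸ ∣ G ∣) C suc c ℕ.+ (n ∸ ∣ G ∣) C c)
      ≡⟨ cong +_ (trans (ℕ.+-comm ((n ∸ ∣ G ∣) C suc c) _) (nCk+nC[k+1]≡[n+1]C[k+1] (n ∸ ∣ G ∣) c)) ⟩
  + (suc (n ∸ ∣ G ∣) C suc c)
      ≡⟨ cong (λ m → + (m C suc c)) (sym (ℕ.+-∸-assoc 1 (∣p∣≤n G))) ⟩
  + ((suc n ∸ ∣ G ∣) C suc c) ∎
  where open ≡-Reasoning

∑ₛ-ofSize : ∀ n c → ∑ₛ n (λ A → 𝟙 (∣ A ∣ ℕ.≟ c)) ≡ + (n C c)
∑ₛ-ofSize n c = begin
  ∑ₛ n (λ A → 𝟙 (∣ A ∣ ℕ.≟ c))                 ≡⟨ ∑-cong (allSubsets n) (λ A → sym (ℤ.*-identityʳ _)) ⟩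
  ∑ₛ n (λ A → 𝟙 (∣ A ∣ ℕ.≟ c) * 1ℤ)            ≡⟨ ∑-cong (allSubsets n) (λ A → cong (𝟙 (∣ A ∣ ℕ.≟ c) *_)
                                                     (sym (𝟙-yes {P = ∅ ⊆ ∁ A} ⊥⊆ (∅ ⊆? ∁ A)))) ⟩
  ∑ₛ n (λ A → 𝟙 (∣ A ∣ ℕ.≟ c) * 𝟙 (∅ ⊆? ∁ A)) ≡⟨ ∑ₛ-ofSize-disjoint n ∅ c ⟩
  + ((n ∸ ∣ ∅ {n} ∣) C c)                      ≡⟨ cong (λ m → + ((n ∸ m) C c)) (∣⊥∣≡0 n) ⟩
  + (n C c)                                    ∎
  where open ≡-Reasoning

∑ₛ-∁ : ∀ n (f : Subset n → ℤ) → ∑ₛ n (f ∘ ∁) ≡ ∑ₛ n f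
∑ₛ-∁ n = SubsetEnumeration.∑-reindex n ∁ ∁ ∁-involutive ∁-involutive

𝟙-∣∁p∣≟ : ∀ {n ℓ} (p : Subset n) → ℓ ≤ n → 𝟙 (∣ ∁ p ∣ ℕ.≟ ℓ) ≡ 𝟙 (∣ p ∣ ℕ.≟ n ∸ ℓ)
𝟙-∣∁p∣≟ {n} p ℓ≤n = 𝟙-cong (λ ∣∁p∣≡ℓ → trans (∣p∣≡n∸∣∁p∣ p) (cong (n ∸_) ∣∁p∣≡ℓ))
                            (λ ∣p∣≡n∸ℓ → trans (∣∁p∣≡n∸∣p∣ p) (trans (cong (n ∸_) ∣p∣≡n∸ℓ) (ℕ.m∸[m∸n]≡n ℓ≤n)))
                            (∣ ∁ p ∣ ℕ.≟ _) (∣ p ∣ ℕ.≟ _)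

-- Complementation turns supersets of G into sets disjoint from G.
∑ₛ-ofSize-superset : ∀ n (G : Subset n) {ℓ} → ℓ ≤ n →
  ∑ₛ n (λ A → 𝟙 (∣ A ∣ ℕ.≟ ℓ) * 𝟙 (G ⊆? A)) ≡ + ((n ∸ ∣ G ∣) C (n ∸ ℓ))
∑ₛ-ofSize-superset n G {ℓ} ℓ≤n = begin
  ∑ₛ n (λ A → 𝟙 (∣ A ∣ ℕ.≟ ℓ) * 𝟙 (G ⊆? A))             ≡⟨ sym (∑ₛ-∁ n _) ⟩
  ∑ₛ n (λ B → 𝟙 (∣ ∁ B ∣ ℕ.≟ ℓ) * 𝟙 (G ⊆? ∁ B))         ≡⟨ ∑-cong (allSubsets n) (λ B → cong (_* 𝟙 (G ⊆? ∁ B)) (𝟙-∣∁p∣≟ B ℓ≤n)) ⟩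
  ∑ₛ n (λ B → 𝟙 (∣ B ∣ ℕ.≟ n ∸ ℓ) * 𝟙 (G ⊆? ∁ B))       ≡⟨ ∑ₛ-ofSize-disjoint n G (n ∸ ℓ) ⟩
  + ((n ∸ ∣ G ∣) C (n ∸ ℓ))                              ∎
  where open ≡-Reasoning

-- Vandermonde's identity

sumFrom : (ℕ → ℕ) → ℕ → ℕ → ℕ
sumFrom f a zero    = 0
sumFrom f a (suc m) = f a ℕ.+ sumFrom f (suc a) m

sumFrom-cong : ∀ {f g} → (∀ h → f h ≡ g h) → ∀ a m → sumFrom f a m ≡ sumFrom g a m
sumFrom-cong f≗g a zero    = refl
sumFrom-cong f≗g a (suc m) = cong₂ ℕ._+_ (f≗g a) (sumFrom-cong f≗g (suc a) m)

sumFrom-suc : ∀ f a m → sumFrom f (suc a) m ≡ sumFrom (f ∘ suc) a m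
sumFrom-suc f a zero    = refl
sumFrom-suc f a (suc m) = cong (f (suc a) ℕ.+_) (sumFrom-suc f (suc a) m)

sumFrom-shift : ∀ f a m → sumFrom f a m ≡ sumFrom (λ i → f (a ℕ.+ i)) 0 m
sumFrom-shift f zero    m = refl
sumFrom-shift f (suc a) m = trans (sumFrom-suc f a m) (sumFrom-shift (f ∘ suc) a m)

sumFrom-distrib-+ : ∀ f g a m → sumFrom (λ h → f h ℕ.+ g h) a m ≡ sumFrom f a m ℕ.+ sumFrom g a m
sumFrom-distrib-+ f g a zero    = refl
sumFrom-distrib-+ f g a (suc m) =
  trans (cong (f a ℕ.+ g a ℕ.+_) (sumFrom-distrib-+ f g (suc a) m))
        (ℕ+.interchange (f a) (g a) (sumFrom f (suc a) m) (sumFrom g (suc a) m))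

sumFrom-++ : ∀ f a m₁ m₂ → sumFrom f a (m₁ ℕ.+ m₂) ≡ sumFrom f a m₁ ℕ.+ sumFrom f (a ℕ.+ m₁) m₂
sumFrom-++ f a zero     m₂ = cong (λ b → sumFrom f b m₂) (sym (ℕ.+-identityʳ a))
sumFrom-++ f a (suc m₁) m₂ = begin
  f a ℕ.+ sumFrom f (suc a) (m₁ ℕ.+ m₂)                          ≡⟨ cong (f a ℕ.+_) (sumFrom-++ f (suc a) m₁ m₂) ⟩
  f a ℕ.+ (sumFrom f (suc a) m₁ ℕ.+ sumFrom f (suc a ℕ.+ m₁) m₂) ≡⟨ sym (ℕ.+-assoc (f a) _ _) ⟩
  f a ℕ.+ sumFrom f (suc a) m₁ ℕ.+ sumFrom f (suc (a ℕ.+ m₁)) m₂ ≡⟨ cong (λ b → f a ℕ.+ sumFrom f (suc a) m₁ ℕ.+ sumFrom f b m₂)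
                                                                          (sym (ℕ.+-suc a m₁)) ⟩
  f a ℕ.+ sumFrom f (suc a) m₁ ℕ.+ sumFrom f (a ℕ.+ suc m₁) m₂   ∎
  where open ≡-Reasoning

sumFrom-0 : ∀ f a m → (∀ h → a ≤ h → h < a ℕ.+ m → f h ≡ 0) → sumFrom f a m ≡ 0
sumFrom-0 f a zero    _    = refl
sumFrom-0 f a (suc m) f≡0 = cong₂ ℕ._+_
  (f≡0 a ℕ.≤-refl (ℕ.m<m+n a (s≤s z≤n)))
  (sumFrom-0 f (suc a) m (λ h a<h h<a+m → f≡0 h (ℕ.<⇒≤ a<h) (subst (h <_) (sym (ℕ.+-suc a m)) h<a+m)))

sumBetween : (ℕ → ℕ) → ℕ → ℕ → ℕ
sumBetween f a b = sumFrom f a (b ∸ a)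

sumBetween-split : ∀ f {a b c} → a ≤ b → b ≤ c → sumBetween f a c ≡ sumBetween f a b ℕ.+ sumBetween f b c
sumBetween-split f {a} {b} {c} a≤b b≤c = begin
  sumFrom f a (c ∸ a)                                     ≡⟨ cong (sumFrom f a) c∸a≡ ⟩
  sumFrom f a ((b ∸ a) ℕ.+ (c ∸ b))                       ≡⟨ sumFrom-++ f a (b ∸ a) (c ∸ b) ⟩
  sumFrom f a (b ∸ a) ℕ.+ sumFrom f (a ℕ.+ (b ∸ a)) (c ∸ b) ≡⟨ cong (λ d → sumFrom f a (b ∸ a) ℕ.+ sumFrom f d (c ∸ b))
                                                                      (ℕ.m+[n∸m]≡n a≤b) ⟩
  sumFrom f a (b ∸ a) ℕ.+ sumFrom f b (c ∸ b)             ∎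
  where
  open ≡-Reasoning
  c∸a≡ : c ∸ a ≡ (b ∸ a) ℕ.+ (c ∸ b)
  c∸a≡ = begin
    c ∸ a                    ≡⟨ cong (_∸ a) (sym (ℕ.m∸n+n≡m b≤c)) ⟩
    (c ∸ b) ℕ.+ b ∸ a        ≡⟨ ℕ.+-∸-assoc (c ∸ b) a≤b ⟩
    (c ∸ b) ℕ.+ (b ∸ a)      ≡⟨ ℕ.+-comm (c ∸ b) (b ∸ a) ⟩
    (b ∸ a) ℕ.+ (c ∸ b)      ∎

sumBetween-0 : ∀ f {a b} → a ≤ b → (∀ h → a ≤ h → h < b → f h ≡ 0) → sumBetween f a b ≡ 0
sumBetween-0 f {a} {b} a≤b f≡0 =
  sumFrom-0 f a (b ∸ a) (λ h a≤h h<b → f≡0 h a≤h (subst (h <_) (ℕ.m+[n∸m]≡n a≤b) h<b))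

sumRange≡sumBetween : ∀ a b f → sumRange a b f ≡ sumBetween f a (suc b)
sumRange≡sumBetween a b f = trans (sum-applyUpTo (λ i → f (a ℕ.+ i)) (λ i → i) (suc b ∸ a)) (sym (sumFrom-shift f a (suc b ∸ a)))
  where
  sum-applyUpTo : ∀ g k m → sum (List.map g (applyUpTo k m)) ≡ sumFrom (g ∘ k) 0 m
  sum-applyUpTo g k zero    = refl
  sum-applyUpTo g k (suc m) = cong (g (k 0) ℕ.+_)
    (trans (sum-applyUpTo g (k ∘ suc) m) (sym (sumFrom-suc (g ∘ k) 0 m)))

vandermonde : ∀ g m ℓ → sumFrom (λ h → (g C h) ℕ.* (m C (ℓ ∸ h))) 0 (suc ℓ) ≡ (g ℕ.+ m) C ℓ
vandermonde zero    m ℓ       = begin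
  m C ℓ ℕ.+ 0 ℕ.+ sumFrom (λ h → (0 C h) ℕ.* (m C (ℓ ∸ h))) 1 ℓ ≡⟨ cong₂ ℕ._+_ (ℕ.+-identityʳ (m C ℓ)) vanish ⟩
  m C ℓ ℕ.+ 0                                                   ≡⟨ ℕ.+-identityʳ (m C ℓ) ⟩
  m C ℓ                                                         ∎
  where
  open ≡-Reasoning
  vanish : sumFrom (λ h → (0 C h) ℕ.* (m C (ℓ ∸ h))) 1 ℓ ≡ 0
  vanish = sumFrom-0 _ 1 ℓ (λ h 1≤h _ → cong (ℕ._* (m C (ℓ ∸ h))) (k>n⇒nCk≡0 1≤h))
vandermonde (suc g) m zero    = refl
vandermonde (suc g) m (suc ℓ) = begin
  m C suc ℓ ℕ.+ 0 ℕ.+ sumFrom (λ h → (suc g C h) ℕ.* (m C (suc ℓ ∸ h))) 1 (suc ℓ)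
    ≡⟨ cong₂ ℕ._+_ (ℕ.+-identityʳ (m C suc ℓ)) (sumFrom-suc _ 0 (suc ℓ)) ⟩
  m C suc ℓ ℕ.+ sumFrom (λ h → (suc g C suc h) ℕ.* (m C (ℓ ∸ h))) 0 (suc ℓ)
    ≡⟨ cong (m C suc ℓ ℕ.+_) (sumFrom-cong pascal 0 (suc ℓ)) ⟩
  m C suc ℓ ℕ.+ sumFrom (λ h → (g C h) ℕ.* (m C (ℓ ∸ h)) ℕ.+ W h) 0 (suc ℓ)
    ≡⟨ cong (m C suc ℓ ℕ.+_) (sumFrom-distrib-+ _ W 0 (suc ℓ)) ⟩
  m C suc ℓ ℕ.+ (sumFrom (λ h → (g C h) ℕ.* (m C (ℓ ∸ h))) 0 (suc ℓ) ℕ.+ sumFrom W 0 (suc ℓ))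
    ≡⟨ ℕ+.x∙yz≈y∙xz (m C suc ℓ) (sumFrom (λ h → (g C h) ℕ.* (m C (ℓ ∸ h))) 0 (suc ℓ)) (sumFrom W 0 (suc ℓ)) ⟩
  sumFrom (λ h → (g C h) ℕ.* (m C (ℓ ∸ h))) 0 (suc ℓ) ℕ.+ (m C suc ℓ ℕ.+ sumFrom W 0 (suc ℓ))
    ≡⟨ cong₂ ℕ._+_ (vandermonde g m ℓ) (trans lift (vandermonde g m (suc ℓ))) ⟩
  (g ℕ.+ m) C ℓ ℕ.+ (g ℕ.+ m) C suc ℓ
    ≡⟨ nCk+nC[k+1]≡[n+1]C[k+1] (g ℕ.+ m) ℓ ⟩
  (suc g ℕ.+ m) C suc ℓ
    ∎
  where
  open ≡-Reasoning
  W : ℕ → ℕ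
  W h = (g C suc h) ℕ.* (m C (ℓ ∸ h))
  pascal : ∀ h → (suc g C suc h) ℕ.* (m C (ℓ ∸ h)) ≡ (g C h) ℕ.* (m C (ℓ ∸ h)) ℕ.+ W h
  pascal h = trans (cong (ℕ._* (m C (ℓ ∸ h))) (sym (nCk+nC[k+1]≡[n+1]C[k+1] g h)))
                   (ℕ.*-distribʳ-+ (m C (ℓ ∸ h)) (g C h) (g C suc h))
  lift : m C suc ℓ ℕ.+ sumFrom W 0 (suc ℓ) ≡ sumFrom (λ h → (g C h) ℕ.* (m C (suc ℓ ∸ h))) 0 (suc (suc ℓ))
  lift = cong₂ ℕ._+_ (sym (ℕ.+-identityʳ (m C suc ℓ))) (sym (sumFrom-suc _ 0 (suc ℓ)))

m<n∸o⇒o<n∸m : ∀ {m n o} → m < n ∸ o → o < n ∸ m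
m<n∸o⇒o<n∸m {m} {n} {o} m<n∸o = ℕ.m+n≤o⇒m≤o∸n (suc o) (subst (_≤ n) (cong suc (ℕ.+-comm m o)) m+o<n)
  where
  o≤n : o ≤ n
  o≤n = ℕ.<⇒≤ (ℕ.m∸n≢0⇒n<m (ℕ.n>0⇒n≢0 (ℕ.≤-trans (s≤s z≤n) m<n∸o)))
  m+o<n : suc m ℕ.+ o ≤ n
  m+o<n = ℕ.m≤o∸n⇒m+n≤o (suc m) o≤n m<n∸o

-- Vandermonde's identity with its term h = 0 moved to the right; the terms with h < ℓ + g - N or
-- h > min(ℓ, g) vanish.
vandermonde-truncated : ∀ {N g ℓ} → g ≤ N → ℓ ≤ N →
  sumRange (1 ⊔ ((ℓ ℕ.+ g) ∸ N)) (ℓ ⊓ g) (λ h → (g C h) ℕ.* ((N ∸ g) C (ℓ ∸ h))) ℕ.+ (N ∸ g) C ℓ ≡ N C ℓ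
vandermonde-truncated {N} {g} {ℓ} g≤N ℓ≤N = begin
  sumRange lo hi f ℕ.+ (N ∸ g) C ℓ                        ≡⟨ cong (ℕ._+ (N ∸ g) C ℓ) (sumRange≡sumBetween lo hi f) ⟩
  sumBetween f lo (suc hi) ℕ.+ (N ∸ g) C ℓ                ≡⟨ cong (ℕ._+ (N ∸ g) C ℓ) (sym trim) ⟩
  sumFrom f 1 ℓ ℕ.+ (N ∸ g) C ℓ                          ≡⟨ ℕ.+-comm (sumFrom f 1 ℓ) _ ⟩
  (N ∸ g) C ℓ ℕ.+ sumFrom f 1 ℓ                          ≡⟨ cong (ℕ._+ sumFrom f 1 ℓ) (sym (ℕ.+-identityʳ _)) ⟩
  sumFrom f 0 (suc ℓ)                                    ≡⟨ vandermonde g (N ∸ g) ℓ ⟩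
  (g ℕ.+ (N ∸ g)) C ℓ                                    ≡⟨ cong (_C ℓ) (ℕ.m+[n∸m]≡n g≤N) ⟩
  N C ℓ                                                  ∎
  where
  open ≡-Reasoning
  f : ℕ → ℕ
  f h = (g C h) ℕ.* ((N ∸ g) C (ℓ ∸ h))
  x lo hi : ℕ
  x = (ℓ ℕ.+ g) ∸ N
  lo = 1 ⊔ x
  hi = ℓ ⊓ g
  x≡ℓ∸[N∸g] : x ≡ ℓ ∸ (N ∸ g)
  x≡ℓ∸[N∸g] = begin
    (ℓ ℕ.+ g) ∸ N               ≡⟨ cong₂ _∸_ (ℕ.+-comm ℓ g) (sym (ℕ.m+[n∸m]≡n g≤N)) ⟩
    (g ℕ.+ ℓ) ∸ (g ℕ.+ (N ∸ g)) ≡⟨ ℕ.[m+n]∸[m+o]≡n∸o g ℓ (N ∸ g) ⟩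
    ℓ ∸ (N ∸ g)                 ∎
  x≤hi : x ≤ hi
  x≤hi = ℕ.⊓-glb (subst (_≤ ℓ) (sym x≡ℓ∸[N∸g]) (ℕ.m∸n≤m ℓ (N ∸ g)))
                (ℕ.≤-trans (ℕ.∸-monoʳ-≤ (ℓ ℕ.+ g) ℓ≤N) (ℕ.≤-reflexive (ℕ.m+n∸m≡n ℓ g)))
  below : ∀ h → 1 ≤ h → h < lo → f h ≡ 0
  below h 1≤h h<lo = trans (cong ((g C h) ℕ.*_) (k>n⇒nCk≡0 (m<n∸o⇒o<n∸m (subst (h <_) x≡ℓ∸[N∸g] (h<x x refl h<lo)))))
                           (ℕ.*-zeroʳ (g C h))
    where
    h<x : ∀ y → y ≡ x → h < 1 ⊔ y → h < x
    h<x zero    _   h<1 = ⊥-elim (ℕ.<-irrefl refl (ℕ.≤-trans h<1 1≤h))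
    h<x (suc y) y≡x h<y = subst (h <_) y≡x h<y
  above : ∀ h → suc hi ≤ h → h < suc ℓ → f h ≡ 0
  above h hi<h h≤ℓ = cong (ℕ._* ((N ∸ g) C (ℓ ∸ h)))
    (k>n⇒nCk≡0 (ℕ.≰⇒> (λ h≤g → ℕ.<⇒≱ hi<h (ℕ.⊓-glb (ℕ.≤-pred h≤ℓ) h≤g))))
  trim : sumFrom f 1 ℓ ≡ sumBetween f lo (suc hi)
  trim = begin
    sumBetween f 1 (suc ℓ)
      ≡⟨ sumBetween-split f 1≤lo (ℕ.≤-trans lo≤hi+1 hi+1≤ℓ+1) ⟩
    sumBetween f 1 lo ℕ.+ sumBetween f lo (suc ℓ)
      ≡⟨ cong₂ ℕ._+_ (sumBetween-0 f 1≤lo below) (sumBetween-split f lo≤hi+1 hi+1≤ℓ+1) ⟩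
    sumBetween f lo (suc hi) ℕ.+ sumBetween f (suc hi) (suc ℓ)
      ≡⟨ cong (sumBetween f lo (suc hi) ℕ.+_) (sumBetween-0 f hi+1≤ℓ+1 above) ⟩
    sumBetween f lo (suc hi) ℕ.+ 0
      ≡⟨ ℕ.+-identityʳ _ ⟩
    sumBetween f lo (suc hi) ∎
    where
    1≤lo : 1 ≤ lo
    1≤lo = ℕ.m≤m⊔n 1 x
    lo≤hi+1 : lo ≤ suc hi
    lo≤hi+1 = ℕ.⊔-lub (s≤s z≤n) (ℕ.m≤n⇒m≤1+n x≤hi)
    hi+1≤ℓ+1 : suc hi ≤ suc ℓ
    hi+1≤ℓ+1 = s≤s (ℕ.m⊓n≤m ℓ g)

-- The crosscut theorem for the lattice 𝓔(𝒢)

module Crosscut {n : ℕ} (𝒢 : List (Subset n)) where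

  μ : Subset n → ℤ
  μ = μ0̂ 𝒢

  ∑𝓔 : (Subset n → ℤ) → ℤ
  ∑𝓔 = ∑ (𝓔 𝒢)

  mobiusF-stable : ∀ {m m'} G → ∣ G ∣ < m → ∣ G ∣ < m' → mobiusF 𝒢 m G ≡ mobiusF 𝒢 m' G
  mobiusF-stable {suc m} {suc m'} G (s≤s ∣G∣≤m) (s≤s ∣G∣≤m') = cong (λ s → - (1ℤ + s))
    (∑-filter-cong (_⊂? G) (𝓔 𝒢) (λ H H⊂G →
      mobiusF-stable H (ℕ.<-≤-trans (p⊂q⇒∣p∣<∣q∣ H⊂G) ∣G∣≤m) (ℕ.<-≤-trans (p⊂q⇒∣p∣<∣q∣ H⊂G) ∣G∣≤m')))

  μ-rec : ∀ G → μ G ≡ - (1ℤ + ∑ (filter (_⊂? G) (𝓔 𝒢)) μ)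
  μ-rec G = cong (λ s → - (1ℤ + s))
    (∑-filter-cong (_⊂? G) (𝓔 𝒢) (λ H H⊂G → mobiusF-stable H (p⊂q⇒∣p∣<∣q∣ H⊂G) ℕ.≤-refl))

  ∈𝓔⇒union : ∀ {G} → G ∈ 𝓔 𝒢 → IsUnion 𝒢 G
  ∈𝓔⇒union = proj₂ ∘ ∈-filter⁻ (isUnion? 𝒢) {xs = allSubsets n}

  ⋃ : (𝒢' : List (Subset n)) → Subset (length 𝒢') → Subset n
  ⋃ = unionOf 𝒢

  Hit : Subset n → Set
  Hit A = Any (_⊆ A) 𝒢

  hit? : ∀ A → Dec (Hit A)
  hit? A = Any.any? (_⊆? A) 𝒢

  hit-mono : ∀ {G A} → Hit G → G ⊆ A → Hit A
  hit-mono hit G⊆A = Any.map (λ F⊆G {x} x∈F → G⊆A (F⊆G x∈F)) hit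

  ⋃-hit : ∀ 𝒢' S → Nonempty S → Any (_⊆ ⋃ 𝒢' S) 𝒢'
  ⋃-hit (F ∷ 𝒢') (true  ∷ S) _                 = here (p⊆p∪q _)
  ⋃-hit (F ∷ 𝒢') (false ∷ S) (suc x , there x∈S) = there (⋃-hit 𝒢' S (x , x∈S))

  union⇒hit : ∀ {G} → IsUnion 𝒢 G → Hit G
  union⇒hit u with satisfied u
  ... | S , S≢∅ , refl = ⋃-hit 𝒢 S S≢∅

  module _ (A : Subset n) where

    membersIn : (𝒢' : List (Subset n)) → Subset (length 𝒢')
    membersIn []       = []
    membersIn (F ∷ 𝒢') = does (F ⊆? A) ∷ membersIn 𝒢'

    ⋃-membersIn⊆ : ∀ 𝒢' → ⋃ 𝒢' (membersIn 𝒢') ⊆ A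
    ⋃-membersIn⊆ []       = ⊥⊆
    ⋃-membersIn⊆ (F ∷ 𝒢') with F ⊆? A
    ... | yes F⊆A = ∪-least F⊆A (⋃-membersIn⊆ 𝒢')
    ... | no  _   = ⋃-membersIn⊆ 𝒢'

    ⊆⋃-membersIn : ∀ 𝒢' S → ⋃ 𝒢' S ⊆ A → ⋃ 𝒢' S ⊆ ⋃ 𝒢' (membersIn 𝒢')
    ⊆⋃-membersIn []       []          _ = ⊆-refl
    ⊆⋃-membersIn (F ∷ 𝒢') (true ∷ S)  ⋃⊆A with F ⊆? A
    ... | yes _   = ∪-least (p⊆p∪q _) (⊆-trans (⊆⋃-membersIn 𝒢' S (⊆-trans (q⊆p∪q F _) ⋃⊆A)) (q⊆p∪q F _))
    ... | no F⊈A = ⊥-elim (F⊈A (⊆-trans (p⊆p∪q _) ⋃⊆A))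
    ⊆⋃-membersIn (F ∷ 𝒢') (false ∷ S) ⋃⊆A with F ⊆? A
    ... | yes _ = ⊆-trans (⊆⋃-membersIn 𝒢' S ⋃⊆A) (q⊆p∪q F _)
    ... | no  _ = ⊆⋃-membersIn 𝒢' S ⋃⊆A

    membersIn-nonempty : ∀ {𝒢'} → Any (_⊆ A) 𝒢' → Nonempty (membersIn 𝒢')
    membersIn-nonempty {F ∷ _}  (here F⊆A) with F ⊆? A
    ... | yes _   = zero , here
    ... | no F⊈A = ⊥-elim (F⊈A F⊆A)
    membersIn-nonempty {_ ∷ 𝒢'} (there hit) with membersIn-nonempty hit
    ... | x , x∈ = suc x , there x∈

  𝟙-⊆-split : ∀ (G U : Subset n) → 𝟙 (G ⊆? U) ≡ 𝟙 (G ≟ₛ U) + 𝟙 (G ⊂? U)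
  𝟙-⊆-split G U with G ≟ₛ U
  ... | yes refl = trans (𝟙-yes {P = G ⊆ G} ⊆-refl (G ⊆? G)) (sym (cong (λ s → 1ℤ + s) (𝟙-no (⊂-irref refl) (G ⊂? G))))
  ... | no  G≢U  = trans (𝟙-cong {P = G ⊆ U} {Q = G ⊂ U} (λ G⊆U → ⊆∧≢⇒⊂ G⊆U G≢U) proj₁ (G ⊆? U) (G ⊂? U)) (sym (ℤ.+-identityˡ _))

  -- If A contains a member of 𝒢, the unions below A are exactly those below the largest one, U.
  ∑𝓔-below-hit : ∀ A → Hit A → ∑𝓔 (λ G → 𝟙 (G ⊆? A) * μ G) ≡ - 1ℤ
  ∑𝓔-below-hit A hit = begin
    ∑𝓔 (λ G → 𝟙 (G ⊆? A) * μ G)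
      ≡⟨ ∑-filter-cong (isUnion? 𝒢) (allSubsets n) (λ G u → cong (_* μ G) (below-U G u)) ⟩
    ∑𝓔 (λ G → 𝟙 (G ⊆? U) * μ G)
      ≡⟨ ∑-cong (𝓔 𝒢) (λ G → trans (cong (_* μ G) (𝟙-⊆-split G U)) (ℤ.*-distribʳ-+ (μ G) (𝟙 (G ≟ₛ U)) (𝟙 (G ⊂? U)))) ⟩
    ∑𝓔 (λ G → 𝟙 (G ≟ₛ U) * μ G + 𝟙 (G ⊂? U) * μ G)
      ≡⟨ ∑-distrib-+ (𝓔 𝒢) _ _ ⟩
    ∑𝓔 (λ G → 𝟙 (G ≟ₛ U) * μ G) + ∑𝓔 (λ G → 𝟙 (G ⊂? U) * μ G)
      ≡⟨ cong₂ _+_ (SubsetEnumeration.∑-filter-δ n (isUnion? 𝒢) U-union μ) (sym (∑-filter (_⊂? U) (𝓔 𝒢) μ)) ⟩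
    μ U + ∑ (filter (_⊂? U) (𝓔 𝒢)) μ
      ≡⟨ cong (_+ ∑ (filter (_⊂? U) (𝓔 𝒢)) μ) (μ-rec U) ⟩
    - (1ℤ + ∑ (filter (_⊂? U) (𝓔 𝒢)) μ) + ∑ (filter (_⊂? U) (𝓔 𝒢)) μ
      ≡⟨ cancel (∑ (filter (_⊂? U) (𝓔 𝒢)) μ) ⟩
    - 1ℤ ∎
    where
    open ≡-Reasoning
    U = ⋃ 𝒢 (membersIn A 𝒢)
    U-union : IsUnion 𝒢 U
    U-union = lose (∈-allSubsets (length 𝒢) (membersIn A 𝒢)) (membersIn-nonempty A hit , refl)
    below-U : ∀ G → IsUnion 𝒢 G → 𝟙 (G ⊆? A) ≡ 𝟙 (G ⊆? U)
    below-U G u with satisfied u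
    ... | S , _ , refl = 𝟙-cong {P = G ⊆ A} {Q = G ⊆ U} (⊆⋃-membersIn A 𝒢 S) (λ G⊆U → ⊆-trans G⊆U (⋃-membersIn⊆ A 𝒢))
                                (G ⊆? A) (G ⊆? U)
    cancel : ∀ x → - (1ℤ + x) + x ≡ - 1ℤ
    cancel = ℤ-Solver.solve-∀

  ∑𝓔-below-miss : ∀ A → ¬ Hit A → ∑𝓔 (λ G → 𝟙 (G ⊆? A) * μ G) ≡ 0ℤ
  ∑𝓔-below-miss A miss = trans
    (∑-filter-cong (isUnion? 𝒢) (allSubsets n) {g = λ _ → 0ℤ}
       (λ G u → cong (_* μ G) (𝟙-no (miss ∘ hit-mono (union⇒hit u)) (G ⊆? A))))
    (∑-0 (𝓔 𝒢) (λ _ → refl))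

  𝟙-avoid : ∀ A → 𝟙 (¬? (hit? A)) ≡ 1ℤ + ∑𝓔 (λ G → 𝟙 (G ⊆? A) * μ G)
  𝟙-avoid A with hit? A
  ... | yes hit = sym (cong (λ s → 1ℤ + s) (∑𝓔-below-hit A hit))
  ... | no miss = sym (cong (λ s → 1ℤ + s) (∑𝓔-below-miss A miss))

  ∑𝓔-μ : Hit ⊤ₛ → ∑𝓔 μ ≡ - 1ℤ
  ∑𝓔-μ hit = trans (∑-cong (𝓔 𝒢) (λ G → sym (trans (cong (_* μ G) (𝟙-yes {P = G ⊆ ⊤ₛ} ⊆⊤ (G ⊆? ⊤ₛ))) (ℤ.*-identityˡ (μ G)))))
                   (∑𝓔-below-hit ⊤ₛ hit)

  ∑ₛ-ofSize-avoiding-image : ∀ (φ : Subset n → Subset n) c →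
    ∑ₛ n (λ A → 𝟙 (∣ A ∣ ℕ.≟ c) * 𝟙 (¬? (hit? (φ A))))
      ≡ + (n C c) + ∑𝓔 (λ G → μ G * ∑ₛ n (λ A → 𝟙 (∣ A ∣ ℕ.≟ c) * 𝟙 (G ⊆? φ A)))
  ∑ₛ-ofSize-avoiding-image φ c = begin
    ∑ₛ n (λ A → 𝟙 (∣ A ∣ ℕ.≟ c) * 𝟙 (¬? (hit? (φ A))))
      ≡⟨ ∑-cong (allSubsets n) (λ A → trans (cong (ofSize A *_) (𝟙-avoid (φ A)))
                                            (trans (ℤ.*-distribˡ-+ (ofSize A) 1ℤ (below A))
                                                   (cong (_+ ofSize A * below A) (ℤ.*-identityʳ (ofSize A))))) ⟩
    ∑ₛ n (λ A → ofSize A + ofSize A * ∑𝓔 (λ G → 𝟙 (G ⊆? φ A) * μ G))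
      ≡⟨ ∑-distrib-+ (allSubsets n) ofSize _ ⟩
    ∑ₛ n ofSize + ∑ₛ n (λ A → ofSize A * ∑𝓔 (λ G → 𝟙 (G ⊆? φ A) * μ G))
      ≡⟨ cong₂ _+_ (∑ₛ-ofSize n c) (∑-*-∑ (allSubsets n) (𝓔 𝒢) ofSize (λ A G → 𝟙 (G ⊆? φ A) * μ G)) ⟩
    + (n C c) + ∑𝓔 (λ G → ∑ₛ n (λ A → ofSize A * (𝟙 (G ⊆? φ A) * μ G)))
      ≡⟨ cong (λ s → + (n C c) + s) (∑-cong (𝓔 𝒢) pull-μ) ⟩
    + (n C c) + ∑𝓔 (λ G → μ G * ∑ₛ n (λ A → ofSize A * 𝟙 (G ⊆? φ A))) ∎
    where
    open ≡-Reasoning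
    ofSize : Subset n → ℤ
    ofSize A = 𝟙 (∣ A ∣ ℕ.≟ c)
    below : Subset n → ℤ
    below A = ∑𝓔 (λ G → 𝟙 (G ⊆? φ A) * μ G)
    pull-μ : ∀ G → ∑ₛ n (λ A → ofSize A * (𝟙 (G ⊆? φ A) * μ G)) ≡ μ G * ∑ₛ n (λ A → ofSize A * 𝟙 (G ⊆? φ A))
    pull-μ G = trans (∑-cong (allSubsets n) (λ A → sym (ℤ.*-assoc (ofSize A) _ (μ G))))
                     (trans (∑-*ʳ (allSubsets n) (μ G) _) (ℤ.*-comm _ (μ G)))

  ∑ₛ-ofSize-avoiding : ∀ {ℓ} → ℓ ≤ n →
    ∑ₛ n (λ A → 𝟙 (∣ A ∣ ℕ.≟ ℓ) * 𝟙 (¬? (hit? A)))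
      ≡ + (n C (n ∸ ℓ)) + ∑𝓔 (λ G → μ G * + ((n ∸ ∣ G ∣) C (n ∸ ℓ)))
  ∑ₛ-ofSize-avoiding {ℓ} ℓ≤n = trans (∑ₛ-ofSize-avoiding-image (λ A → A) ℓ) (cong₂ _+_
    (cong +_ (nCk≡nC[n∸k] ℓ≤n))
    (∑-cong (𝓔 𝒢) (λ G → cong (μ G *_) (∑ₛ-ofSize-superset n G ℓ≤n))))

  ∑ₛ-coSize-avoiding : ∀ {ℓ} → ℓ ≤ n →
    ∑ₛ n (λ A → 𝟙 (∣ A ∣ ℕ.≟ n ∸ ℓ) * 𝟙 (¬? (hit? A)))
      ≡ + (n C ℓ) + ∑𝓔 (λ G → μ G * + ((n ∸ ∣ G ∣) C ℓ))
  ∑ₛ-coSize-avoiding {ℓ} ℓ≤n = begin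
    ∑ₛ n (λ A → 𝟙 (∣ A ∣ ℕ.≟ n ∸ ℓ) * 𝟙 (¬? (hit? A)))
      ≡⟨ sym (∑ₛ-∁ n _) ⟩
    ∑ₛ n (λ B → 𝟙 (∣ ∁ B ∣ ℕ.≟ n ∸ ℓ) * 𝟙 (¬? (hit? (∁ B))))
      ≡⟨ ∑-cong (allSubsets n) (λ B → cong (_* 𝟙 (¬? (hit? (∁ B))))
           (trans (𝟙-∣∁p∣≟ B (ℕ.m∸n≤m n ℓ)) (cong (λ m → 𝟙 (∣ B ∣ ℕ.≟ m)) (ℕ.m∸[m∸n]≡n ℓ≤n)))) ⟩
    ∑ₛ n (λ B → 𝟙 (∣ B ∣ ℕ.≟ ℓ) * 𝟙 (¬? (hit? (∁ B))))
      ≡⟨ ∑ₛ-ofSize-avoiding-image ∁ ℓ ⟩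
    + (n C ℓ) + ∑𝓔 (λ G → μ G * ∑ₛ n (λ B → 𝟙 (∣ B ∣ ℕ.≟ ℓ) * 𝟙 (G ⊆? ∁ B)))
      ≡⟨ cong (λ s → + (n C ℓ) + s) (∑-cong (𝓔 𝒢) (λ G → cong (μ G *_) (∑ₛ-ofSize-disjoint n G ℓ))) ⟩
    + (n C ℓ) + ∑𝓔 (λ G → μ G * + ((n ∸ ∣ G ∣) C ℓ)) ∎
    where open ≡-Reasoning

module Occurrences {a : Level} {A : Set a} (_≟_ : DecidableEquality A) where

  δ : A → A → ℕ
  δ x y = if does (x ≟ y) then 1 else 0

  count : A → List A → ℕ
  count y []       = 0
  count y (x ∷ xs) = δ x y ℕ.+ count y xs

  count-++ : ∀ y xs ys → count y (xs ++ ys) ≡ count y xs ℕ.+ count y ys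
  count-++ y []       ys = refl
  count-++ y (x ∷ xs) ys = trans (cong (_ ℕ.+_) (count-++ y xs ys)) (sym (ℕ.+-assoc (δ x y) (count y xs) (count y ys)))

  count-filter : ∀ {p} {P : A → Set p} (P? : Decidable P) y xs → count y (filter P? xs) ≤ count y xs
  count-filter P? y []       = z≤n
  count-filter P? y (x ∷ xs) with does (P? x)
  ... | true  = ℕ.+-monoʳ-≤ _ (count-filter P? y xs)
  ... | false = ℕ.≤-trans (count-filter P? y xs) (ℕ.m≤n+m _ _)

  count-∈ : ∀ {y xs} → y ∈ xs → 1 ≤ count y xs
  count-∈ {xs = x ∷ xs} (here refl) with x ≟ x
  ... | yes _  = s≤s z≤n
  ... | no x≢x = ⊥-elim (x≢x refl)
  count-∈ {xs = x ∷ xs} (there y∈xs) = ℕ.≤-trans (count-∈ y∈xs) (ℕ.m≤n+m _ _)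

  lookup-injective : ∀ xs → (∀ y → count y xs ≤ 1) → ∀ {i j} → List.lookup xs i ≡ List.lookup xs j → i ≡ j
  lookup-injective (x ∷ xs) once {zero}  {zero}  _  = refl
  lookup-injective (x ∷ xs) once {zero}  {suc j} eq = ⊥-elim (twice (subst (_∈ xs) (sym eq) (∈-lookup j)))
    where
    twice : x ∈ xs → ⊥
    twice x∈xs with x ≟ x | once x
    ... | yes _  | s≤s count≤0 = ℕ.1+n≰n (ℕ.≤-trans (count-∈ x∈xs) count≤0)
    ... | no x≢x | _           = x≢x refl
  lookup-injective (x ∷ xs) once {suc i} {zero}  eq = sym (lookup-injective (x ∷ xs) once {zero} {suc i} (sym eq))
  lookup-injective (x ∷ xs) once {suc i} {suc j} eq =
    cong suc (lookup-injective xs (λ y → ℕ.≤-trans (ℕ.m≤n+m _ _) (once y)) eq)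

negS-involutive : ∀ s → negS (negS s) ≡ s
negS-involutive s0 = refl
negS-involutive s+ = refl
negS-involutive s- = refl

negV-involutive : ∀ {t} (X : SignVec t) → negV (negV X) ≡ X
negV-involutive []      = refl
negV-involutive (s ∷ X) = cong₂ _∷_ (negS-involutive s) (negV-involutive X)

negS-swap : ∀ {s y} → negS s ≡ y → s ≡ negS y
negS-swap {s} refl = sym (negS-involutive s)

lookup-negV : ∀ {t} (X : SignVec t) e → negV X ⟨ e ⟩ ≡ negS (X ⟨ e ⟩)
lookup-negV X e = lookup-map e negS X

extend : ∀ {t} → SignVec t → List (SignVec (suc t))
extend v = (s0 ∷ v) ∷ (s+ ∷ v) ∷ (s- ∷ v) ∷ []

∈-allSignVecs : ∀ t (X : SignVec t) → X ∈ allSignVecs t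
∈-allSignVecs zero    []      = here refl
∈-allSignVecs (suc t) (s ∷ X) = ∈-concatMap⁺ extend (Any.map (∈-extend s) (∈-allSignVecs t X))
  where
  ∈-extend : ∀ s {v} → X ≡ v → (s ∷ X) ∈ extend v
  ∈-extend s0 refl = here refl
  ∈-extend s+ refl = there (here refl)
  ∈-extend s- refl = there (there (here refl))

module SignVecOccurrences {t : ℕ} = Occurrences (≡-dec {n = t} _≟S_)
open SignVecOccurrences

count-allSignVecs : ∀ t (Y : SignVec t) → count Y (allSignVecs t) ≡ 1
count-allSignVecs zero    []      = refl
count-allSignVecs (suc t) (s ∷ Y) = trans (count-concatMap (allSignVecs t)) (count-allSignVecs t Y)
  where
  count-extend : ∀ s v → count (s ∷ Y) (extend v) ≡ δ v Y
  count-extend s0 v = ℕ.+-identityʳ (δ v Y)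
  count-extend s+ v = ℕ.+-identityʳ (δ v Y)
  count-extend s- v = ℕ.+-identityʳ (δ v Y)
  count-concatMap : ∀ vs → count (s ∷ Y) (concatMap extend vs) ≡ count Y vs
  count-concatMap []       = refl
  count-concatMap (v ∷ vs) = trans (count-++ (s ∷ Y) (extend v) (concatMap extend vs))
                                   (cong₂ ℕ._+_ (count-extend s v) (count-concatMap vs))

module Topes {t : ℕ} (M : OrientedMatroid t) where
  open OrientedMatroid M

  T : Fin (#T M) → SignVec t
  T = tope M

  isTope-T : ∀ i → IsTope M (T i)
  isTope-T i = proj₂ (∈-filter⁻ (isTope? M) {xs = allSignVecs t} (∈-lookup i))

  ∈-topes : ∀ {X} → IsTope M X → X ∈ topes M
  ∈-topes {X} = ∈-filter⁺ (isTope? M) (∈-allSignVecs t X)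

  T-injective : ∀ {i j} → T i ≡ T j → i ≡ j
  T-injective = lookup-injective (topes M) λ Y →
    ℕ.≤-trans (count-filter (isTope? M) Y (allSignVecs t)) (ℕ.≤-reflexive (count-allSignVecs t Y))

  isTope-negV : ∀ {X} → IsTope M X → IsTope M (negV X)
  isTope-negV {X} (X-cov , X-max) = neg-cov X-cov , λ Y Y-cov -X≼Y →
    trans (sym (negV-involutive Y)) (cong negV (X-max (negV Y) (neg-cov Y-cov) (≼-negV {Y} -X≼Y)))
    where
    ≼-negV : ∀ {Y} → negV X ≼ Y → X ≼ negV Y
    ≼-negV {Y} -X≼Y e with -X≼Y e
    ... | inj₁ -Xe≡0  = inj₁ (negS-swap (trans (sym (lookup-negV X e)) -Xe≡0))
    ... | inj₂ -Xe≡Ye = inj₂ (trans (negS-swap (trans (sym (lookup-negV X e)) -Xe≡Ye)) (sym (lookup-negV Y e)))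

  σ : Fin (#T M) → Fin (#T M)
  σ i = Any.index (∈-topes (isTope-negV (isTope-T i)))

  T-σ : ∀ i → T (σ i) ≡ negV (T i)
  T-σ i = sym (lookup-index (∈-topes (isTope-negV (isTope-T i))))

  σ-involutive : ∀ i → σ (σ i) ≡ i
  σ-involutive i = T-injective (trans (T-σ (σ i)) (trans (cong negV (T-σ i)) (negV-involutive (T i))))

  module _ (loopless : ∀ e → ¬ IsLoop M e) where

    -- Were T i ⟨ e ⟩ = 0, maximality would give T i ∘ X = T i, hence X ⟨ e ⟩ = 0, for every covector X.
    T-nonzero : ∀ i e → T i ⟨ e ⟩ ≢ s0
    T-nonzero i e Te≡0 = loopless e λ X X-cov → begin
      X ⟨ e ⟩              ≡⟨ cong (_∘S X ⟨ e ⟩) (sym Te≡0) ⟩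
      T i ⟨ e ⟩ ∘S X ⟨ e ⟩ ≡⟨ sym (lookup-zipWith _∘S_ e (T i) X) ⟩
      (T i ∘V X) ⟨ e ⟩     ≡⟨ cong (_⟨ e ⟩) (proj₂ (isTope-T i) (T i ∘V X) (comp-cov (proj₁ (isTope-T i)) X-cov) (T≼T∘X X)) ⟩
      T i ⟨ e ⟩            ≡⟨ Te≡0 ⟩
      s0                   ∎
      where
      open ≡-Reasoning
      absorbs : ∀ s y → s ≡ s0 ⊎ s ≡ s ∘S y
      absorbs s0 y = inj₁ refl
      absorbs s+ y = inj₂ refl
      absorbs s- y = inj₂ refl
      T≼T∘X : ∀ X → T i ≼ (T i ∘V X)
      T≼T∘X X f = map₂ (λ eq → trans eq (sym (lookup-zipWith _∘S_ f (T i) X))) (absorbs (T i ⟨ f ⟩) (X ⟨ f ⟩))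

    -- The membership indicator inside halfspace is local to its definition; lookup∘tabulate exposes it.
    halfspace-σ : ∀ e i → Vec.lookup (halfspace M e) (σ i) ≡ not (Vec.lookup (halfspace M e) i)
    halfspace-σ e i
      rewrite (Vec.lookup (halfspace M e) (σ i) ≡ _ ∋ lookup∘tabulate _ (σ i))
            | (Vec.lookup (halfspace M e) i ≡ _ ∋ lookup∘tabulate _ i)
            | T-σ i | lookup-negV (T i) e
      with T i ⟨ e ⟩ | T-nonzero i e
    ... | s0 | Te≢0 = ⊥-elim (Te≢0 refl)
    ... | s+ | _    = refl
    ... | s- | _    = refl

m+n≡o⇒+m≡+o-+n : ∀ {m n o} → m ℕ.+ n ≡ o → + m ≡ + o ℤ.- + n
m+n≡o⇒+m≡+o-+n {m} {n} refl = trans (cancel (+ m) (+ n)) (cong (_+ - + n) (sym (ℤ.pos-+ m n)))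
  where
  cancel : ∀ x y → x ≡ x + y + - y
  cancel = ℤ-Solver.solve-∀

2*m≡m+m : ∀ m → 2 ℕ.* m ≡ m ℕ.+ m
2*m≡m+m m = cong (m ℕ.+_) (ℕ.+-identityʳ m)

x+y≡k⇒[k<2x⇔y<x] : ∀ x y {k} → x ℕ.+ y ≡ k → (k < 2 ℕ.* x ⇔ y < x)
x+y≡k⇒[k<2x⇔y<x] x y refl = mk⇔
  (λ k<2x → ℕ.+-cancelˡ-< x y x (subst (x ℕ.+ y <_) (2*m≡m+m x) k<2x))
  (λ y<x → subst (x ℕ.+ y <_) (sym (2*m≡m+m x)) (ℕ.+-monoʳ-< x y<x))

x+y≡k⇒[2y<k⇔y<x] : ∀ x y {k} → x ℕ.+ y ≡ k → (2 ℕ.* y < k ⇔ y < x)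
x+y≡k⇒[2y<k⇔y<x] x y refl = mk⇔
  (λ 2y<k → ℕ.+-cancelˡ-< y y x (subst₂ _<_ (2*m≡m+m y) (ℕ.+-comm x y) 2y<k))
  (λ y<x → subst₂ _<_ (sym (2*m≡m+m y)) (ℕ.+-comm y x) (ℕ.+-monoʳ-< y y<x))

m+n∸o<n⇔m<o : ∀ m n {o} → o ≤ m ℕ.+ n → (m ℕ.+ n ∸ o < n ⇔ m < o)
m+n∸o<n⇔m<o m n {o} o≤m+n = mk⇔
  (λ lt → ℕ.+-cancelʳ-< n m o (subst (_< o ℕ.+ n) (ℕ.m+[n∸m]≡n o≤m+n) (ℕ.+-monoʳ-< o lt)))
  (λ m<o → ℕ.+-cancelˡ-< o _ n (subst (_< o ℕ.+ n) (sym (ℕ.m+[n∸m]≡n o≤m+n)) (ℕ.+-monoˡ-< n m<o)))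

2*c<ℓ⇔c<⌊[ℓ+1]/2⌋ : ∀ c ℓ → 2 ℕ.* c < ℓ ⇔ c < (ℓ ℕ.+ 1) / 2
2*c<ℓ⇔c<⌊[ℓ+1]/2⌋ c ℓ = mk⇔
  (λ 2c<ℓ → ℕ.≤-trans (ℕ.≤-reflexive (sym (m*n/n≡m (suc c) 2)))
                      (/-monoˡ-≤ 2 (subst (_≤ ℓ ℕ.+ 1) (sym (double-suc c)) (ℕ.+-monoˡ-≤ 1 2c<ℓ))))
  (λ c<j → ℕ.+-cancelʳ-≤ 1 (suc (2 ℕ.* c)) ℓ
    (subst (_≤ ℓ ℕ.+ 1) (double-suc c) (ℕ.≤-trans (ℕ.*-monoˡ-≤ 2 c<j) (m/n*n≤m (ℓ ℕ.+ 1) 2))))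
  where
  double-suc : ∀ c → suc c ℕ.* 2 ≡ suc (2 ℕ.* c) ℕ.+ 1
  double-suc = ℕ-Solver.solve-∀

module HalfspaceCrosscut {t : ℕ} (M : OrientedMatroid t) (j : ℕ) where
  open Crosscut (halfspaceFamily M j) public

  ∈-halfspaceFamily⁻ : ∀ {F} → F ∈ halfspaceFamily M j → HalfspaceFamily M j F
  ∈-halfspaceFamily⁻ = proj₂ ∘ ∈-filter⁻ _ {xs = allSubsets (#T M)}

  hit⇒large : ∀ {A} → Hit A → Σ (Fin t) λ e → j ≤ ∣ A ∩ halfspace M e ∣
  hit⇒large hit with find hit
  ... | F , F∈ , F⊆A with ∈-halfspaceFamily⁻ F∈
  ...   | ∣F∣≡j , e , F⊆H = e , subst (_≤ _) ∣F∣≡j (p⊆q⇒∣p∣≤∣q∣ (λ {x} x∈F → x∈p∩q⁺ (F⊆A x∈F , F⊆H x∈F)))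

  large⇒hit : ∀ A e → j ≤ ∣ A ∩ halfspace M e ∣ → Hit A
  large⇒hit A e j≤ with subsetOfSize (A ∩ halfspace M e) j j≤
  ... | F , F⊆A∩H , ∣F∣≡j =
    lose (∈-filter⁺ _ (∈-allSubsets _ F) (∣F∣≡j , e , λ {x} x∈F → p∩q⊆q A _ (F⊆A∩H x∈F)))
         (λ {x} x∈F → p∩q⊆p A _ (F⊆A∩H x∈F))

  ∈𝓔⇒j≤∣G∣ : ∀ {G} → G ∈ 𝓔 (halfspaceFamily M j) → j ≤ ∣ G ∣
  ∈𝓔⇒j≤∣G∣ {G} G∈𝓔 with find (union⇒hit (∈𝓔⇒union G∈𝓔))
  ... | F , F∈ , F⊆G = subst (_≤ ∣ G ∣) (proj₁ (∈-halfspaceFamily⁻ F∈)) (p⊆q⇒∣p∣≤∣q∣ F⊆G)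

module Committees {t : ℕ} (M : OrientedMatroid t) (loopless : ∀ e → ¬ IsLoop M e) where
  open Topes M

  N : ℕ
  N = #T M

  H : Fin t → Subset N
  H = halfspace M

  opp : Subset N → Subset N
  opp K = tabulate (λ i → Vec.lookup K (σ i))

  lookup-opp : ∀ K i → Vec.lookup (opp K) i ≡ Vec.lookup K (σ i)
  lookup-opp K i = lookup∘tabulate (λ i → Vec.lookup K (σ i)) i

  opp-involutive : ∀ K → opp (opp K) ≡ K
  opp-involutive K = trans (tabulate-cong (λ i → trans (lookup-opp K (σ i)) (cong (Vec.lookup K) (σ-involutive i))))
                           (tabulate∘lookup K)

  ∑-σ : ∀ (f : Fin N → ℤ) → ∑ (allFin N) (f ∘ σ) ≡ ∑ (allFin N) f
  ∑-σ = FinEnumeration.∑-reindex N σ σ σ-involutive σ-involutive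

  ∣opp∣ : ∀ K → ∣ opp K ∣ ≡ ∣ K ∣
  ∣opp∣ K = ℤ.+-injective (begin
    + ∣ opp K ∣                                       ≡⟨ ∣p∣≡∑ (opp K) ⟩
    ∑ (allFin N) (λ i → 𝟙ᵇ (Vec.lookup (opp K) i))    ≡⟨ ∑-cong (allFin N) (λ i → cong 𝟙ᵇ (lookup-opp K i)) ⟩
    ∑ (allFin N) (λ i → 𝟙ᵇ (Vec.lookup K (σ i)))      ≡⟨ ∑-σ (𝟙ᵇ ∘ Vec.lookup K) ⟩
    ∑ (allFin N) (λ i → 𝟙ᵇ (Vec.lookup K i))          ≡⟨ sym (∣p∣≡∑ K) ⟩
    + ∣ K ∣                                           ∎)
    where open ≡-Reasoning

  -- The opposite of a tope in K lies in H e exactly when that tope does not.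
  ∣opp∩H∣+∣∩H∣ : ∀ K e → ∣ opp K ∩ H e ∣ ℕ.+ ∣ K ∩ H e ∣ ≡ ∣ K ∣
  ∣opp∩H∣+∣∩H∣ K e = ℤ.+-injective (begin
    + ∣ opp K ∩ H e ∣ + + ∣ K ∩ H e ∣
      ≡⟨ cong₂ _+_ (card∩ (opp K)) (card∩ K) ⟩
    ∑ (allFin N) (λ i → 𝟙ᵇ (Vec.lookup (opp K) i ∧ Vec.lookup (H e) i)) + ∑ (allFin N) (λ i → 𝟙ᵇ (Vec.lookup K i ∧ Vec.lookup (H e) i))
      ≡⟨ cong (_+ ∑ (allFin N) (λ i → 𝟙ᵇ (Vec.lookup K i ∧ Vec.lookup (H e) i)))
              (trans (∑-cong (allFin N) (λ i → cong₂ (λ b c → 𝟙ᵇ (b ∧ c)) (lookup-opp K i) (H-σ i)))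
                     (∑-σ (λ i → 𝟙ᵇ (Vec.lookup K i ∧ not (Vec.lookup (H e) i))))) ⟩
    ∑ (allFin N) (λ i → 𝟙ᵇ (Vec.lookup K i ∧ not (Vec.lookup (H e) i))) + ∑ (allFin N) (λ i → 𝟙ᵇ (Vec.lookup K i ∧ Vec.lookup (H e) i))
      ≡⟨ sym (∑-distrib-+ (allFin N) _ _) ⟩
    ∑ (allFin N) (λ i → 𝟙ᵇ (Vec.lookup K i ∧ not (Vec.lookup (H e) i)) + 𝟙ᵇ (Vec.lookup K i ∧ Vec.lookup (H e) i))
      ≡⟨ ∑-cong (allFin N) (λ i → 𝟙ᵇ-split (Vec.lookup K i) (Vec.lookup (H e) i)) ⟩
    ∑ (allFin N) (λ i → 𝟙ᵇ (Vec.lookup K i))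
      ≡⟨ sym (∣p∣≡∑ K) ⟩
    + ∣ K ∣ ∎)
    where
    open ≡-Reasoning
    card∩ : ∀ X → + ∣ X ∩ H e ∣ ≡ ∑ (allFin N) (λ i → 𝟙ᵇ (Vec.lookup X i ∧ Vec.lookup (H e) i))
    card∩ X = trans (∣p∣≡∑ (X ∩ H e)) (∑-cong (allFin N) (λ i → cong 𝟙ᵇ (lookup-zipWith _∧_ i X (H e))))
    H-σ : ∀ i → Vec.lookup (H e) i ≡ not (Vec.lookup (H e) (σ i))
    H-σ i = trans (cong (Vec.lookup (H e)) (sym (σ-involutive i))) (halfspace-σ loopless e (σ i))
    𝟙ᵇ-split : ∀ b c → 𝟙ᵇ (b ∧ not c) + 𝟙ᵇ (b ∧ c) ≡ 𝟙ᵇ b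
    𝟙ᵇ-split false c     = refl
    𝟙ᵇ-split true  false = refl
    𝟙ᵇ-split true  true  = refl

  ∣H∣+∣H∣≡N : ∀ e → ∣ H e ∣ ℕ.+ ∣ H e ∣ ≡ N
  ∣H∣+∣H∣≡N e = begin
    ∣ H e ∣ ℕ.+ ∣ H e ∣                       ≡⟨ sym (cong₂ ℕ._+_ (cong ∣_∣ (∩-identityˡ (H e))) (cong ∣_∣ (∩-identityˡ (H e)))) ⟩
    ∣ ⊤ₛ ∩ H e ∣ ℕ.+ ∣ ⊤ₛ ∩ H e ∣              ≡⟨ cong (λ X → ∣ X ∩ H e ∣ ℕ.+ ∣ ⊤ₛ ∩ H e ∣) (sym opp-⊤) ⟩
    ∣ opp ⊤ₛ ∩ H e ∣ ℕ.+ ∣ ⊤ₛ ∩ H e ∣          ≡⟨ ∣opp∩H∣+∣∩H∣ ⊤ₛ e ⟩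
    ∣ ⊤ₛ {N} ∣                                ≡⟨ ∣⊤∣≡n N ⟩
    N                                         ∎
    where
    open ≡-Reasoning
    opp-⊤ : opp ⊤ₛ ≡ ⊤ₛ
    opp-⊤ = trans (tabulate-cong (λ i → trans (lookup-replicate (σ i) true) (sym (lookup-replicate i true))))
                  (tabulate∘lookup ⊤ₛ)

  IsAntiCommittee : ℕ → Subset N → Set
  IsAntiCommittee ℓ A = ∣ A ∣ ≡ ℓ × (∀ e → 2 ℕ.* ∣ A ∩ H e ∣ < ℓ)

  isAntiCommittee? : ∀ ℓ A → Dec (IsAntiCommittee ℓ A)
  isAntiCommittee? ℓ A = (∣ A ∣ ℕ.≟ ℓ) ×-dec all? (λ e → 2 ℕ.* ∣ A ∩ H e ∣ ℕ.<? ℓ)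

  committee⇔anti-opp : ∀ k K → IsCommittee M k K ⇔ IsAntiCommittee k (opp K)
  committee⇔anti-opp k K = mk⇔
    (λ (∣K∣≡k , maj) → trans (∣opp∣ K) ∣K∣≡k , λ e →
      Equivalence.from (minority ∣K∣≡k e) (Equivalence.to (majority ∣K∣≡k e) (maj e)))
    (λ (∣-K∣≡k , min) → let ∣K∣≡k = trans (sym (∣opp∣ K)) ∣-K∣≡k in ∣K∣≡k , λ e →
      Equivalence.from (majority ∣K∣≡k e) (Equivalence.to (minority ∣K∣≡k e) (min e)))
    where
    split : ∣ K ∣ ≡ k → ∀ e → ∣ K ∩ H e ∣ ℕ.+ ∣ opp K ∩ H e ∣ ≡ k
    split ∣K∣≡k e = trans (ℕ.+-comm ∣ K ∩ H e ∣ _) (trans (∣opp∩H∣+∣∩H∣ K e) ∣K∣≡k)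
    majority : ∣ K ∣ ≡ k → ∀ e → k < 2 ℕ.* ∣ K ∩ H e ∣ ⇔ ∣ opp K ∩ H e ∣ < ∣ K ∩ H e ∣
    majority ∣K∣≡k e = x+y≡k⇒[k<2x⇔y<x] ∣ K ∩ H e ∣ ∣ opp K ∩ H e ∣ (split ∣K∣≡k e)
    minority : ∣ K ∣ ≡ k → ∀ e → 2 ℕ.* ∣ opp K ∩ H e ∣ < k ⇔ ∣ opp K ∩ H e ∣ < ∣ K ∩ H e ∣
    minority ∣K∣≡k e = x+y≡k⇒[2y<k⇔y<x] ∣ K ∩ H e ∣ ∣ opp K ∩ H e ∣ (split ∣K∣≡k e)

  anti⇔committee-∁ : ∀ ℓ A → ℓ ≤ N → IsAntiCommittee ℓ A ⇔ IsCommittee M (N ∸ ℓ) (∁ A)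
  anti⇔committee-∁ ℓ A ℓ≤N = mk⇔
    (λ (∣A∣≡ℓ , min) → trans (∣∁p∣≡n∸∣p∣ A) (cong (N ∸_) ∣A∣≡ℓ) , λ e →
      Equivalence.from (balance e) (min e))
    (λ (∣∁A∣≡N∸ℓ , maj) → trans (∣p∣≡n∸∣∁p∣ A) (trans (cong (N ∸_) ∣∁A∣≡N∸ℓ) (ℕ.m∸[m∸n]≡n ℓ≤N)) , λ e →
      Equivalence.to (balance e) (maj e))
    where
    N≡ : ∀ e → 2 ℕ.* ∣ A ∩ H e ∣ ℕ.+ 2 ℕ.* ∣ ∁ A ∩ H e ∣ ≡ N
    N≡ e = trans (regroup ∣ A ∩ H e ∣ ∣ ∁ A ∩ H e ∣)
                 (trans (cong (λ h → h ℕ.+ h) (∣∁p∩q∣+∣p∩q∣≡∣q∣ A (H e))) (∣H∣+∣H∣≡N e))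
      where
      regroup : ∀ a a' → 2 ℕ.* a ℕ.+ 2 ℕ.* a' ≡ (a' ℕ.+ a) ℕ.+ (a' ℕ.+ a)
      regroup = ℕ-Solver.solve-∀
    balance : ∀ e → N ∸ ℓ < 2 ℕ.* ∣ ∁ A ∩ H e ∣ ⇔ 2 ℕ.* ∣ A ∩ H e ∣ < ℓ
    balance e = subst (λ n → n ∸ ℓ < 2 ℕ.* ∣ ∁ A ∩ H e ∣ ⇔ 2 ℕ.* ∣ A ∩ H e ∣ < ℓ) (N≡ e)
                      (m+n∸o<n⇔m<o (2 ℕ.* ∣ A ∩ H e ∣) (2 ℕ.* ∣ ∁ A ∩ H e ∣) (subst (ℓ ≤_) (sym (N≡ e)) ℓ≤N))

  #anti : ℕ → ℤ
  #anti ℓ = ∑ₛ N (λ A → 𝟙 (isAntiCommittee? ℓ A))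

  #committees≡#anti : ∀ k → + #committees M k ≡ #anti k
  #committees≡#anti k = begin
    + #committees M k                                  ≡⟨ length-filter≡∑𝟙 (isCommittee? M k) (allSubsets N) ⟩
    ∑ₛ N (λ K → 𝟙 (isCommittee? M k K))                ≡⟨ ∑-cong (allSubsets N) (λ K →
                                                            𝟙-cong (Equivalence.to (committee⇔anti-opp k K))
                                                                   (Equivalence.from (committee⇔anti-opp k K))
                                                                   (isCommittee? M k K) (isAntiCommittee? k (opp K))) ⟩
    ∑ₛ N (λ K → 𝟙 (isAntiCommittee? k (opp K)))        ≡⟨ SubsetEnumeration.∑-reindex N opp opp opp-involutive opp-involutive _ ⟩
    #anti k                                            ∎
    where open ≡-Reasoning

  #committees≡#anti[N∸k] : ∀ k → k ≤ N → + #committees M k ≡ #anti (N ∸ k)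
  #committees≡#anti[N∸k] k k≤N = begin
    + #committees M k                                      ≡⟨ length-filter≡∑𝟙 (isCommittee? M k) (allSubsets N) ⟩
    ∑ₛ N (λ K → 𝟙 (isCommittee? M k K))                    ≡⟨ sym (∑ₛ-∁ N _) ⟩
    ∑ₛ N (λ A → 𝟙 (isCommittee? M k (∁ A)))                ≡⟨ ∑-cong (allSubsets N) (λ A → sym (𝟙-cong
                                                                (Equivalence.to (co A)) (Equivalence.from (co A))
                                                                (isAntiCommittee? (N ∸ k) A) (isCommittee? M k (∁ A)))) ⟩
    #anti (N ∸ k)                                          ∎
    where
    open ≡-Reasoning
    co : ∀ A → IsAntiCommittee (N ∸ k) A ⇔ IsCommittee M k (∁ A)
    co A = subst (λ m → IsAntiCommittee (N ∸ k) A ⇔ IsCommittee M m (∁ A)) (ℕ.m∸[m∸n]≡n k≤N)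
                 (anti⇔committee-∁ (N ∸ k) A (ℕ.m∸n≤m N k))

  module Family (ℓ : ℕ) = HalfspaceCrosscut M ((ℓ ℕ.+ 1) / 2)

  anti⇔avoid : ∀ ℓ A → IsAntiCommittee ℓ A ⇔ (∣ A ∣ ≡ ℓ × ¬ Family.Hit ℓ A)
  anti⇔avoid ℓ A = mk⇔
    (λ (∣A∣≡ℓ , min) → ∣A∣≡ℓ , λ hit →
      let e , j≤ = hit⇒large hit in ℕ.<⇒≱ (Equivalence.to (2*c<ℓ⇔c<⌊[ℓ+1]/2⌋ _ ℓ) (min e)) j≤)
    (λ (∣A∣≡ℓ , miss) → ∣A∣≡ℓ , λ e →
      Equivalence.from (2*c<ℓ⇔c<⌊[ℓ+1]/2⌋ _ ℓ) (ℕ.≰⇒> (λ j≤ → miss (large⇒hit A e j≤))))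
    where open Family ℓ

  #anti≡#avoiding : ∀ ℓ → #anti ℓ ≡ ∑ₛ N (λ A → 𝟙 (∣ A ∣ ℕ.≟ ℓ) * 𝟙 (¬? (Family.hit? ℓ A)))
  #anti≡#avoiding ℓ = ∑-cong (allSubsets N) λ A →
    trans (𝟙-cong (Equivalence.to (anti⇔avoid ℓ A)) (Equivalence.from (anti⇔avoid ℓ A))
                  (isAntiCommittee? ℓ A) ((∣ A ∣ ℕ.≟ ℓ) ×-dec ¬? (Family.hit? ℓ A)))
          (𝟙-× (∣ A ∣ ℕ.≟ ℓ) (¬? (Family.hit? ℓ A)))

  1≤⌊[ℓ+1]/2⌋ : ∀ {ℓ} → 1 ≤ ℓ → 1 ≤ (ℓ ℕ.+ 1) / 2
  1≤⌊[ℓ+1]/2⌋ {ℓ} = Equivalence.to (2*c<ℓ⇔c<⌊[ℓ+1]/2⌋ 0 ℓ)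

  #anti≡formula-i : ∀ ℓ → 1 ≤ ℓ → ℓ ≤ N → #anti ℓ ≡ formula-i M ℓ
  #anti≡formula-i ℓ 1≤ℓ ℓ≤N = begin
    #anti ℓ
      ≡⟨ #anti≡#avoiding ℓ ⟩
    ∑ₛ N (λ A → 𝟙 (∣ A ∣ ℕ.≟ ℓ) * 𝟙 (¬? (hit? A)))
      ≡⟨ ∑ₛ-ofSize-avoiding ℓ≤N ⟩
    + (N C (N ∸ ℓ)) + ∑𝓔 (λ G → μ G * + ((N ∸ ∣ G ∣) C (N ∸ ℓ)))
      ≡⟨ cong (λ s → + (N C (N ∸ ℓ)) + s) (sym (∑-filter-redundant _ (𝓔 (halfspaceFamily M _)) vanish)) ⟩
    formula-i M ℓ ∎
    where
    open ≡-Reasoning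
    open Family ℓ
    vanish : ∀ {G} → G ∈ 𝓔 (halfspaceFamily M ((ℓ ℕ.+ 1) / 2)) → ¬ (1 ≤ ∣ G ∣ × ∣ G ∣ ≤ ℓ) →
             μ G * + ((N ∸ ∣ G ∣) C (N ∸ ℓ)) ≡ 0ℤ
    vanish {G} G∈𝓔 out = trans (cong (λ c → μ G * + c) (k>n⇒nCk≡0 (ℕ.∸-monoʳ-< ℓ<∣G∣ (∣p∣≤n G)))) (ℤ.*-zeroʳ (μ G))
      where
      1≤∣G∣ : 1 ≤ ∣ G ∣
      1≤∣G∣ = ℕ.≤-trans (1≤⌊[ℓ+1]/2⌋ 1≤ℓ) (∈𝓔⇒j≤∣G∣ G∈𝓔)
      ℓ<∣G∣ : ℓ < ∣ G ∣
      ℓ<∣G∣ = ℕ.≰⇒> (λ ∣G∣≤ℓ → out (1≤∣G∣ , ∣G∣≤ℓ))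

  #anti≡formula-ii : ∀ ℓ → 1 ≤ ℓ → ℓ ≤ N → 1 ≤ N ∸ ℓ → Fin t → #anti (N ∸ ℓ) ≡ formula-ii M ℓ
  #anti≡formula-ii ℓ 1≤ℓ ℓ≤N 1≤N∸ℓ e₀ = begin
    #anti (N ∸ ℓ)
      ≡⟨ #anti≡#avoiding (N ∸ ℓ) ⟩
    ∑ₛ N (λ A → 𝟙 (∣ A ∣ ℕ.≟ N ∸ ℓ) * 𝟙 (¬? (hit? A)))
      ≡⟨ ∑ₛ-coSize-avoiding ℓ≤N ⟩
    + (N C ℓ) + ∑𝓔 (λ G → μ G * + missing G)
      ≡⟨ sym (regroup (+ (N C ℓ)) (∑𝓔 (λ G → μ G * + missing G))) ⟩
    - (- 1ℤ * + (N C ℓ) + - ∑𝓔 (λ G → μ G * + missing G))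
      ≡⟨ cong (λ s → - (s * + (N C ℓ) + - ∑𝓔 (λ G → μ G * + missing G))) (sym (∑𝓔-μ ⊤-hit)) ⟩
    - (∑𝓔 μ * + (N C ℓ) + - ∑𝓔 (λ G → μ G * + missing G))
      ≡⟨ cong -_ (cong₂ _+_ (sym (∑-*ʳ (𝓔 𝒢) (+ (N C ℓ)) μ)) (sym (∑-neg (𝓔 𝒢) (λ G → μ G * + missing G)))) ⟩
    - (∑𝓔 (λ G → μ G * + (N C ℓ)) + ∑𝓔 (λ G → - (μ G * + missing G)))
      ≡⟨ cong -_ (sym (∑-distrib-+ (𝓔 𝒢) _ _)) ⟩
    - ∑𝓔 (λ G → μ G * + (N C ℓ) + - (μ G * + missing G))
      ≡⟨ cong -_ (∑-cong (𝓔 𝒢) (λ G → sym (meeting G))) ⟩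
    - ∑𝓔 (λ G → μ G * + meets G)
      ≡⟨ cong -_ (sym (∑-filter-redundant _ (𝓔 𝒢) vanish)) ⟩
    formula-ii M ℓ ∎
    where
    open ≡-Reasoning
    open Family (N ∸ ℓ)
    𝒢 : List (Subset N)
    𝒢 = halfspaceFamily M ((N ∸ ℓ ℕ.+ 1) / 2)
    missing meets : Subset N → ℕ
    missing G = (N ∸ ∣ G ∣) C ℓ
    meets G = sumRange (1 ℕ.⊔ ((ℓ ℕ.+ ∣ G ∣) ∸ N)) (ℓ ℕ.⊓ ∣ G ∣) (λ h → (∣ G ∣ C h) ℕ.* ((N ∸ ∣ G ∣) C (ℓ ∸ h)))
    meeting : ∀ G → μ G * + meets G ≡ μ G * + (N C ℓ) + - (μ G * + missing G)
    meeting G = trans (cong (μ G *_) (m+n≡o⇒+m≡+o-+n (vandermonde-truncated (∣p∣≤n G) ℓ≤N))) (distrib (μ G) _ _)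
      where
      distrib : ∀ m c d → m * (c + - d) ≡ m * c + - (m * d)
      distrib = ℤ-Solver.solve-∀
    regroup : ∀ c x → - (- 1ℤ * c + - x) ≡ c + x
    regroup = ℤ-Solver.solve-∀
    ⊤-hit : Hit ⊤ₛ
    ⊤-hit = large⇒hit ⊤ₛ e₀ (subst (_ ≤_) (sym (cong ∣_∣ (∩-identityˡ (H e₀)))) j≤∣H∣)
      where
      N≡2∣H∣ : N ≡ ∣ H e₀ ∣ ℕ.* 2
      N≡2∣H∣ = trans (sym (∣H∣+∣H∣≡N e₀)) (trans (sym (2*m≡m+m ∣ H e₀ ∣)) (ℕ.*-comm 2 ∣ H e₀ ∣))
      j≤∣H∣ : (N ∸ ℓ ℕ.+ 1) / 2 ≤ ∣ H e₀ ∣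
      j≤∣H∣ = ℕ.*-cancelʳ-≤ _ _ 2 (ℕ.≤-trans (m/n*n≤m (N ∸ ℓ ℕ.+ 1) 2)
                (subst₂ _≤_ (ℕ.+-comm 1 (N ∸ ℓ)) N≡2∣H∣ (ℕ.∸-monoʳ-< 1≤ℓ ℓ≤N)))
    vanish : ∀ {G} → G ∈ 𝓔 𝒢 → ¬ (1 ≤ ∣ G ∣) → μ G * + meets G ≡ 0ℤ
    vanish G∈𝓔 ∣G∣<1 = ⊥-elim (∣G∣<1 (ℕ.≤-trans (1≤⌊[ℓ+1]/2⌋ 1≤N∸ℓ) (∈𝓔⇒j≤∣G∣ G∈𝓔)))

  #committees≡#anti-either : ∀ k ℓ → k ≤ N → ℓ ≡ k ⊎ ℓ ≡ N ∸ k →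
    + #committees M k ≡ #anti ℓ × + #committees M k ≡ #anti (N ∸ ℓ)
  #committees≡#anti-either k ℓ k≤N (inj₁ refl) = #committees≡#anti k , #committees≡#anti[N∸k] k k≤N
  #committees≡#anti-either k ℓ k≤N (inj₂ refl) =
    #committees≡#anti[N∸k] k k≤N , trans (#committees≡#anti k) (cong #anti (sym (ℕ.m∸[m∸n]≡n k≤N)))

-- Over the empty ground set the only sign vector is 0, which is not a circuit.
¬acyclic⇒element : ∀ {t} (M : OrientedMatroid t) → ¬ Acyclic M → Fin t
¬acyclic⇒element {zero}  M not-acyclic = ⊥-elim (not-acyclic λ { ([] , (_ , C≢0 , _) , _) → C≢0 refl })
¬acyclic⇒element {suc t} M _           = Fin.zero

either-bounds : ∀ {N k ℓ} → 1 ≤ k → k < N → ℓ ≡ k ⊎ ℓ ≡ N ∸ k → 1 ≤ ℓ × ℓ ≤ N × 1 ≤ N ∸ ℓ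
either-bounds         1≤k k<N (inj₁ refl) = 1≤k , ℕ.<⇒≤ k<N , ℕ.m<n⇒0<n∸m k<N
either-bounds {N} {k} 1≤k k<N (inj₂ refl) =
  ℕ.m<n⇒0<n∸m k<N , ℕ.m∸n≤m N k , subst (1 ≤_) (sym (ℕ.m∸[m∸n]≡n (ℕ.<⇒≤ k<N))) 1≤k

proposition3p1 : (t : ℕ) (M : OrientedMatroid t) → Simple M → ¬ Acyclic M →
    (k ℓ : ℕ) → 3 ≤ k → k ≤ #T M ∸ 3 → (ℓ ≡ k ⊎ ℓ ≡ #T M ∸ k) →
    (#committees M k ≡ #committees M (#T M ∸ k))
    × (+ #committees M k ≡ formula-i M ℓ)
    × (+ #committees M k ≡ formula-ii M ℓ)
proposition3p1 t M simple not-acyclic k ℓ 3≤k k≤N∸3 ℓ∈ =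
  let 1≤ℓ , ℓ≤N , 1≤N∸ℓ = either-bounds 1≤k k<N ℓ∈
      #k≡#anti-ℓ , #k≡#anti-N∸ℓ = #committees≡#anti-either k ℓ k≤N ℓ∈
  in  ℤ.+-injective (trans (#committees≡#anti[N∸k] k k≤N) (sym (#committees≡#anti (N ∸ k))))
    , trans #k≡#anti-ℓ (#anti≡formula-i ℓ 1≤ℓ ℓ≤N)
    , trans #k≡#anti-N∸ℓ (#anti≡formula-ii ℓ 1≤ℓ ℓ≤N 1≤N∸ℓ (¬acyclic⇒element M not-acyclic))
  where
  open Committees M (proj₁ simple)
  1≤k : 1 ≤ k
  1≤k = ℕ.≤-trans (s≤s z≤n) 3≤k
  k<N : k < N
  k<N = ℕ.<-≤-trans (ℕ.m<m+n k (s≤s z≤n)) (ℕ.m≤o∸n⇒m+n≤o k 3≤N k≤N∸3)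
    where
    3≤N : 3 ≤ N
    3≤N = ℕ.<⇒≤ (ℕ.m∸n≢0⇒n<m (ℕ.n>0⇒n≢0 (ℕ.≤-trans 1≤k k≤N∸3)))
  k≤N : k ≤ N
  k≤N = ℕ.<⇒≤ k<N
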